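{- Let the signature consist of binary relation symbols $L,R,U,D$ together with finitely many unary relation symbols. (1) There is no first-order sentence $\phi$ over such a signature such that the restrictions to $\{L,R,U,D\}$ of the finite models of $\phi$ are, up to isomorphism, exactly all rectangular grids. (2) Moreover, there is no first-order sentence $\phi$ over such a signature such that every finite model of $\phi$ restricted to $\{L,R,U,D\}$ is a rectangular grid and there exists $y^*$ such that for every $x^*$ some finite model of $\phi$ restricts to the rectangular grid $\{0,\ldots,x^*\}\times\{0,\ldots,y^*\}$.
   Context: A rectangular grid is a structure $(V,L,R,U,D)$ with $V=\{0,\ldots,x^*\}\times\{0,\ldots,y^*\}$ for integers $x^*,y^*\ge0$, where the binary relations hold exactly in the cases (whenever both vertices exist) $L((x,y),(x-1,y))$, $R((x,y),(x+1,y))$, $U((x,y),(x,y-1))$, $D((x,y),(x,y+1))$. -}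

module Defs where

open import Data.Nat using (ℕ; zero; suc)
open import Data.Fin using (Fin; toℕ) renaming (zero to fz; suc to fs)
open import Data.Bool using (Bool; true; false; _∧_; _∨_; not)
open import Data.Product using (Σ; _×_; _,_; ∃-syntax)
open import Relation.Binary.PropositionalEquality using (_≡_)
open import Function.Bundles using (_↔_; _⇔_; Inverse)
open import Relation.Nullary using (¬_)
open import Relation.Nullary.Decidable using (⌊_⌋)
open import Data.Fin using (_≟_)

data BinSym : Set where
  L R U D : BinSym

-- First-order formulas over the signature {L,R,U,D} ∪ {P_0,…,P_{k-1}}
-- (k unary relation symbols), with n free variables (de Bruijn indices).
data Formula (k : ℕ) : ℕ → Set where
  rel  : ∀ {n} → BinSym → Fin n → Fin n → Formula k n
  un   : ∀ {n} → Fin k → Fin n → Formula k n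
  eq   : ∀ {n} → Fin n → Fin n → Formula k n
  neg  : ∀ {n} → Formula k n → Formula k n
  and  : ∀ {n} → Formula k n → Formula k n → Formula k n
  or   : ∀ {n} → Formula k n → Formula k n → Formula k n
  all  : ∀ {n} → Formula k (suc n) → Formula k n
  ex   : ∀ {n} → Formula k (suc n) → Formula k n

Sentence : ℕ → Set
Sentence k = Formula k 0

-- Finite structures over the signature (carrier Fin size; every finite
-- structure is isomorphic to one of this form).  Relations are Boolean-valued,
-- so satisfaction is classical.
record Structure (k : ℕ) : Set where
  field
    size : ℕ
    relOf : BinSym → Fin size → Fin size → Bool
    unOf  : Fin k → Fin size → Bool
open Structure public

allᵇ : ∀ {m} → (Fin m → Bool) → Bool
allᵇ {zero} f = true
allᵇ {suc m} f = f fz ∧ allᵇ (λ i → f (fs i))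

anyᵇ : ∀ {m} → (Fin m → Bool) → Bool
anyᵇ {zero} f = false
anyᵇ {suc m} f = f fz ∨ anyᵇ (λ i → f (fs i))

extend : ∀ {A : Set} {n} → A → (Fin n → A) → Fin (suc n) → A
extend a ρ fz = a
extend a ρ (fs i) = ρ i

eval : ∀ {k n} (M : Structure k) → Formula k n → (Fin n → Fin (size M)) → Bool
eval M (rel s i j) ρ = relOf M s (ρ i) (ρ j)
eval M (un p i) ρ = unOf M p (ρ i)
eval M (eq i j) ρ = ⌊ ρ i ≟ ρ j ⌋
eval M (neg φ) ρ = not (eval M φ ρ)
eval M (and φ ψ) ρ = eval M φ ρ ∧ eval M ψ ρ
eval M (or φ ψ) ρ = eval M φ ρ ∨ eval M ψ ρ
eval M (all φ) ρ = allᵇ (λ a → eval M φ (extend a ρ))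
eval M (ex φ) ρ = anyᵇ (λ a → eval M φ (extend a ρ))

noVars : ∀ {A : Set} → Fin 0 → A
noVars ()

_⊨_ : ∀ {k} → Structure k → Sentence k → Set
M ⊨ φ = eval M φ noVars ≡ true

GridPt : ℕ → ℕ → Set
GridPt xs ys = Fin (suc xs) × Fin (suc ys)

gridRel : ∀ {xs ys} → BinSym → GridPt xs ys → GridPt xs ys → Set
gridRel L (x , y) (x' , y') = (toℕ x ≡ suc (toℕ x')) × (toℕ y ≡ toℕ y')
gridRel R (x , y) (x' , y') = (toℕ x' ≡ suc (toℕ x)) × (toℕ y ≡ toℕ y')
gridRel U (x , y) (x' , y') = (toℕ x ≡ toℕ x') × (toℕ y ≡ suc (toℕ y'))
gridRel D (x , y) (x' , y') = (toℕ x ≡ toℕ x') × (toℕ y' ≡ suc (toℕ y))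

ReductIsoGrid : ∀ {k} → Structure k → ℕ → ℕ → Set
ReductIsoGrid M xs ys =
  Σ (Fin (size M) ↔ GridPt xs ys) λ f →
    ∀ (s : BinSym) (a b : Fin (size M)) →
      (relOf M s a b ≡ true) ⇔ gridRel s (Inverse.to f a) (Inverse.to f b)

ReductIsGrid : ∀ {k} → Structure k → Set
ReductIsGrid M = ∃[ xs ] ∃[ ys ] ReductIsoGrid M xs ys

DefinesGrids : ∀ {k} → Sentence k → Set
DefinesGrids {k} φ =
  (∀ (M : Structure k) → M ⊨ φ → ReductIsGrid M) ×
  (∀ xs ys → ∃[ M ] (M ⊨ φ × ReductIsoGrid M xs ys))

DefinesFixedHeightGrids : ∀ {k} → Sentence k → Set
DefinesFixedHeightGrids {k} φ =
  (∀ (M : Structure k) → M ⊨ φ → ReductIsGrid M) ×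
  (∃[ ys ] ∀ xs → ∃[ M ] (M ⊨ φ × ReductIsoGrid M xs ys))

module Submission where

-- Both parts reduce to part (2).  Suppose φ, of quantifier rank q, has only
-- grid-shaped finite models, and for a fixed height has models of every width.
-- Put r = 2^q and take a model M of very large width.  Reading each column as the
-- unary predicates holding in its rows, pigeonhole yields two windows of 2r+1
-- columns, c > r+1 apart, with identical labels.  Exchanging the horizontal
-- successors of columns a and b = a+c inside these windows gives a structure B
-- whose horizontal successor has the cycle a+1 → … → b → a+1, so B is not a grid.
-- But within distance r every point of B sees the same labelled neighbourhood as
-- in M, and B has no short horizontal cycles, so an Ehrenfeucht–Fraïssé
-- back-and-forth argument with radii 2^g (halved at each quantifier) shows that M
-- and B agree on sentences of rank ≤ q.  Hence B ⊨ φ, a contradiction.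

module Walks where

  open import Data.Nat as ℕ using (ℕ; zero; suc; _∸_)
  import Data.Nat.Properties as ℕP
  open import Data.Integer as ℤ using (ℤ; +_; -[1+_]; _⊖_; -_)
  import Data.Integer.Properties as ℤP
  open import Data.Fin using (Fin)
  open import Data.Maybe using (Maybe; just; nothing; _>>=_)
  open import Data.Product using (Σ; _×_; _,_)
  open import Data.Sum using (inj₁; inj₂)
  open import Relation.Binary.PropositionalEquality

  >>=-just : ∀ {A B : Set} (m : Maybe A) (h : A → Maybe B) {b} →
             (m >>= h) ≡ just b → Σ A λ a → m ≡ just a × h a ≡ just b
  >>=-just (just a) h e = a , refl , e
  >>=-just nothing h ()

  module _ {n : ℕ} where

    iterate : (Fin n → Maybe (Fin n)) → ℕ → Fin n → Maybe (Fin n)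
    iterate f zero p = just p
    iterate f (suc m) p = iterate f m p >>= f

    iterate-+ : ∀ f m k {p q} → iterate f m p ≡ just q → iterate f k q ≡ iterate f (m ℕ.+ k) p
    iterate-+ f m zero {p} e rewrite ℕP.+-identityʳ m = sym e
    iterate-+ f m (suc k) e rewrite ℕP.+-suc m k | iterate-+ f m k e = refl

    iterate-prefix : ∀ f a b {p q} → iterate f (a ℕ.+ b) p ≡ just q → Σ _ λ r → iterate f a p ≡ just r
    iterate-prefix f a zero e rewrite ℕP.+-identityʳ a = _ , e
    iterate-prefix f a (suc b) {p} e rewrite ℕP.+-suc a b with >>=-just (iterate f (a ℕ.+ b) p) f e
    ... | r , e1 , _ = iterate-prefix f a b e1

    iterate-inverse : ∀ {f g : Fin n → Maybe (Fin n)} → (∀ {p q} → f p ≡ just q → g q ≡ just p) →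
                      ∀ m {p q} → iterate f m p ≡ just q → iterate g m q ≡ just p
    iterate-inverse fg zero refl = refl
    iterate-inverse {f} {g} fg (suc m) {p} e with >>=-just (iterate f m p) f e
    ... | r , e1 , e2 = trans (sym (iterate-+ g 1 m (fg e2))) (iterate-inverse fg m e1)

    zwalk : (f g : Fin n → Maybe (Fin n)) → Fin n → ℤ → Maybe (Fin n)
    zwalk f g p (+ m) = iterate f m p
    zwalk f g p -[1+ m ] = iterate g (suc m) p

    zwalk-swap : ∀ f g p t → zwalk g f p t ≡ zwalk f g p (- t)
    zwalk-swap f g p (+ zero) = refl
    zwalk-swap f g p (+ suc m) = refl
    zwalk-swap f g p -[1+ m ] = refl

    zwalk-neg : ∀ f g p d → zwalk f g p (- (+ d)) ≡ iterate g d p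
    zwalk-neg f g p zero = refl
    zwalk-neg f g p (suc d) = refl

    forward-back : ∀ f g → (∀ {p q} → f p ≡ just q → g q ≡ just p) →
                   ∀ m k {p q} → iterate f m p ≡ just q → iterate g k q ≡ zwalk f g p (m ⊖ k)
    forward-back f g fg m k {p} {q} e with ℕP.≤-<-connex k m
    ... | inj₁ k≤m rewrite ℤP.⊖-≥ k≤m =
      let e' : iterate f ((m ∸ k) ℕ.+ k) p ≡ just q
          e' = subst (λ z → iterate f z p ≡ just q) (sym (ℕP.m∸n+n≡m k≤m)) e
          r , er = iterate-prefix f (m ∸ k) k e'
      in trans (iterate-inverse fg k (trans (iterate-+ f (m ∸ k) k er) e')) (sym er)
    ... | inj₂ m<k rewrite ℤP.⊖-< m<k | zwalk-neg f g p (k ∸ m) =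
      trans (cong (λ z → iterate g z q) (sym (ℕP.m+[n∸m]≡n (ℕP.<⇒≤ m<k))))
            (sym (iterate-+ g m (k ∸ m) (iterate-inverse fg m e)))

  -- A partial successor function together with its inverse (a disjoint union of
  -- paths and cycles).
  record PartialSucc (n : ℕ) : Set where
    field
      next prev : Fin n → Maybe (Fin n)
      next→prev : ∀ {p q} → next p ≡ just q → prev q ≡ just p
      prev→next : ∀ {p q} → prev p ≡ just q → next q ≡ just p

  module Walk {n : ℕ} (G : PartialSucc n) where
    open PartialSucc G

    walk : Fin n → ℤ → Maybe (Fin n)
    walk = zwalk next prev

    walk-+ : ∀ {p q} t s → walk p t ≡ just q → walk q s ≡ walk p (t ℤ.+ s)
    walk-+ (+ m) (+ k) e = iterate-+ next m k e
    walk-+ (+ m) -[1+ k ] e = forward-back next prev next→prev m (suc k) e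
    walk-+ {p} -[1+ m ] (+ k) e =
      trans (forward-back prev next prev→next (suc m) k e)
            (trans (zwalk-swap next prev p (suc m ⊖ k)) (cong (walk p) (sym (ℤP.⊖-swap k (suc m)))))
    walk-+ {p} -[1+ m ] -[1+ k ] e rewrite iterate-+ prev (suc m) (suc k) e | ℕP.+-suc m k = refl

    walk-back : ∀ {p q} t → walk p t ≡ just q → walk q (- t) ≡ just p
    walk-back {p} t e = trans (walk-+ t (- t) e) (cong (walk p) (ℤP.+-inverseʳ t))

module Counting where

  open import Data.Nat using (zero; suc)
  import Data.Nat.Properties as ℕP
  open import Data.Fin using (Fin; toℕ; punchOut)
  open import Data.Fin.Properties using (pigeonhole; punchOut-injective)
  open import Data.Product using (_,_)
  open import Data.Empty using (⊥; ⊥-elim)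
  open import Relation.Nullary using (Dec; yes; no)
  open import Relation.Binary.PropositionalEquality

  -- Extending h by the identity outside T gives an injection
  -- Fin n → Fin n ∖ {p}, which the pigeonhole principle forbids.
  no-injection-missing-a-point :
    ∀ {n} (T : Fin n → Set) (T? : ∀ q → Dec (T q)) (p : Fin n) → T p →
    (h : ∀ q → T q → Fin n) → (∀ q tq → T (h q tq)) → (∀ q tq → h q tq ≢ p) →
    (∀ q1 q2 t1 t2 → h q1 t1 ≡ h q2 t2 → q1 ≡ q2) → ⊥
  no-injection-missing-a-point {zero} T T? () tp h hT hp hinj
  no-injection-missing-a-point {suc n} T T? p tp h hT hp hinj = collision
    where
    H : (q : Fin (suc n)) → Dec (T q) → Fin (suc n)
    H q (yes tq) = h q tq
    H q (no _) = q
    H≢p : ∀ q (d : Dec (T q)) → p ≢ H q d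
    H≢p q (yes tq) e = hp q tq (sym e)
    H≢p q (no ntq) e = ntq (subst T e tp)
    H-injective : ∀ q1 q2 (d1 : Dec (T q1)) (d2 : Dec (T q2)) → H q1 d1 ≡ H q2 d2 → q1 ≡ q2
    H-injective q1 q2 (yes t1) (yes t2) e = hinj q1 q2 t1 t2 e
    H-injective q1 q2 (yes t1) (no n2) e = ⊥-elim (n2 (subst T e (hT q1 t1)))
    H-injective q1 q2 (no n1) (yes t2) e = ⊥-elim (n1 (subst T (sym e) (hT q2 t2)))
    H-injective q1 q2 (no n1) (no n2) e = e
    collision : ⊥
    collision with pigeonhole (ℕP.n<1+n n) (λ q → punchOut (H≢p q (T? q)))
    ... | i , j , i<j , e =
      ℕP.<-irrefl (cong toℕ (H-injective i j (T? i) (T? j) (punchOut-injective (H≢p i (T? i)) (H≢p j (T? j)) e))) i<j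

module Bounded where

  open import Data.Nat as ℕ using (ℕ; zero; suc; _≤_)
  import Data.Nat.Properties as ℕP
  open import Data.Integer as ℤ using (ℤ; +_; -[1+_]; -_; ∣_∣)
  import Data.Integer.Properties as ℤP
  open import Data.Product using (Σ; _×_; _,_)
  open import Data.Sum using (_⊎_; inj₁; inj₂)
  open import Data.Empty using (⊥; ⊥-elim)
  open import Relation.Nullary using (¬_; Dec; yes; no)
  open import Relation.Nullary.Decidable using (¬?)
  open import Relation.Binary.PropositionalEquality

  BEx : ℕ → (ℤ → Set) → Set
  BEx r P = Σ ℤ λ t → ∣ t ∣ ≤ r × P t

  BAll : ℕ → (ℤ → Set) → Set
  BAll r P = ∀ t → ∣ t ∣ ≤ r → P t

  ∣t∣≤0 : ∀ t → ∣ t ∣ ≤ 0 → t ≡ + 0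
  ∣t∣≤0 (+ zero) _ = refl

  ∣t∣≤1+r : ∀ r t → ∣ t ∣ ≤ suc r → ∣ t ∣ ≤ r ⊎ (t ≡ + suc r ⊎ t ≡ -[1+ r ])
  ∣t∣≤1+r r (+ m) le with ℕP.m≤n⇒m<n∨m≡n le
  ... | inj₁ lt = inj₁ (ℕP.≤-pred lt)
  ... | inj₂ refl = inj₂ (inj₁ refl)
  ∣t∣≤1+r r -[1+ m ] le with ℕP.m≤n⇒m<n∨m≡n le
  ... | inj₁ lt = inj₁ (ℕP.≤-pred lt)
  ... | inj₂ refl = inj₂ (inj₂ refl)

  bex? : ∀ r {P : ℤ → Set} → (∀ t → Dec (P t)) → Dec (BEx r P)
  bex? zero {P} P? with P? (+ 0)
  ... | yes p = yes (+ 0 , ℕ.z≤n , p)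
  ... | no ¬p = no λ { (t , le , pt) → ¬p (subst P (∣t∣≤0 t le) pt) }
  bex? (suc r) {P} P? with bex? r P? | P? (+ suc r) | P? -[1+ r ]
  ... | yes (t , le , pt) | _ | _ = yes (t , ℕP.m≤n⇒m≤1+n le , pt)
  ... | no _ | yes pt | _ = yes (+ suc r , ℕP.≤-refl , pt)
  ... | no _ | no _ | yes pt = yes (-[1+ r ] , ℕP.≤-refl , pt)
  ... | no ¬inner | no ¬top | no ¬bottom = no λ { (t , le , pt) → none t le pt }
    where
    none : ∀ t → ∣ t ∣ ≤ suc r → P t → ⊥
    none t le pt with ∣t∣≤1+r r t le
    ... | inj₁ le' = ¬inner (t , le' , pt)
    ... | inj₂ (inj₁ refl) = ¬top pt
    ... | inj₂ (inj₂ refl) = ¬bottom pt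

  ball? : ∀ r {P : ℤ → Set} → (∀ t → Dec (P t)) → Dec (BAll r P)
  ball? r {P} P? with bex? r (λ t → ¬? (P? t))
  ... | yes (t , le , ¬pt) = no λ all → ¬pt (all t le)
  ... | no ¬counter = yes λ t le → holds t le (P? t)
    where
    holds : ∀ t → ∣ t ∣ ≤ r → Dec (P t) → P t
    holds t le (yes pt) = pt
    holds t le (no ¬pt) = ⊥-elim (¬counter (t , le , ¬pt))

  ∣t+s∣≤r+r : ∀ {r} t s → ∣ t ∣ ≤ r → ∣ s ∣ ≤ r → ∣ t ℤ.+ s ∣ ≤ r ℕ.+ r
  ∣t+s∣≤r+r t s a b = ℕP.≤-trans (ℤP.∣i+j∣≤∣i∣+∣j∣ t s) (ℕP.+-mono-≤ a b)

  ∣-t∣≤r : ∀ {r} t → ∣ t ∣ ≤ r → ∣ - t ∣ ≤ r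
  ∣-t∣≤r t le rewrite ℤP.∣-i∣≡∣i∣ t = le

  t-s+s≡t : ∀ t s → (t ℤ.+ - s) ℤ.+ s ≡ t
  t-s+s≡t t s rewrite ℤP.+-assoc t (- s) s | ℤP.+-inverseˡ s = ℤP.+-identityʳ t

-- Local isomorphisms between two successor structures on the same carrier, whose
-- points carry labels compared by a relation _~_, and the one-pebble extension
-- step of the Ehrenfeucht–Fraïssé game on them.
module LocalIsos where

  open import Data.Nat as ℕ using (ℕ; suc; _≤_)
  import Data.Nat.Properties as ℕP
  open import Data.Integer as ℤ using (ℤ; +_; -_; ∣_∣)
  import Data.Integer.Properties as ℤP
  open import Data.Fin using (Fin) renaming (zero to fz; suc to fs)
  open import Data.Fin.Properties using (any?) renaming (_≟_ to _≟F_)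
  open import Data.Maybe using (Maybe; just; nothing)
  import Data.Maybe.Properties as MP
  open import Data.Product using (Σ; _×_; _,_; proj₁; proj₂)
  open import Data.Unit using (⊤; tt)
  open import Data.Empty using (⊥; ⊥-elim)
  open import Relation.Nullary using (¬_; Dec; yes; no)
  open import Relation.Nullary.Decidable using (_×-dec_; ¬?)
  open import Relation.Binary.PropositionalEquality
  open import Defs using (extend)
  open Walks
  open Counting
  open Bounded

  module Labelled {n : ℕ} (_~_ : Fin n → Fin n → Set) where

    _≈_ : Maybe (Fin n) → Maybe (Fin n) → Set
    just x ≈ just y = x ~ y
    nothing ≈ nothing = ⊤
    _ ≈ _ = ⊥

    ≈-justˡ : ∀ m₁ {m₂ y} → m₁ ≈ m₂ → m₂ ≡ just y → Σ (Fin n) λ x → m₁ ≡ just x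
    ≈-justˡ (just x) _ _ = x , refl
    ≈-justˡ nothing {nothing} _ ()
    ≈-justˡ nothing {just _} ()

    ≈-justʳ : ∀ {x} m₂ → just x ≈ m₂ → Σ (Fin n) λ y → m₂ ≡ just y
    ≈-justʳ (just y) _ = y , refl

    record LocalIso (G₁ G₂ : PartialSucc n) (r m : ℕ) (ps ps' : Fin m → Fin n) : Set where
      field
        views : ∀ l t → ∣ t ∣ ≤ r → Walk.walk G₁ (ps l) t ≈ Walk.walk G₂ (ps' l) t
        links : ∀ l l' t → ∣ t ∣ ≤ r →
                Walk.walk G₁ (ps l) t ≡ just (ps l') → Walk.walk G₂ (ps' l) t ≡ just (ps' l')
        links' : ∀ l l' t → ∣ t ∣ ≤ r →
                 Walk.walk G₂ (ps' l) t ≡ just (ps' l') → Walk.walk G₁ (ps l) t ≡ just (ps l')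

    LocalIso-cong : ∀ {G₁ G₂ r m} {ps ps' qs qs' : Fin m → Fin n} →
                    (∀ l → ps l ≡ qs l) → (∀ l → ps' l ≡ qs' l) →
                    LocalIso G₁ G₂ r m ps ps' → LocalIso G₁ G₂ r m qs qs'
    LocalIso-cong {G₁} {G₂} {r} {m} {ps} {ps'} {qs} {qs'} e e' I =
      record { views = views ; links = links ; links' = links' }
      where
      open Walk G₁ renaming (walk to walk₁)
      open Walk G₂ renaming (walk to walk₂)
      views : ∀ l t → ∣ t ∣ ≤ r → walk₁ (qs l) t ≈ walk₂ (qs' l) t
      views l t le = subst₂ (λ x z → walk₁ x t ≈ walk₂ z t) (e l) (e' l) (LocalIso.views I l t le)
      links : ∀ l l' t → ∣ t ∣ ≤ r → walk₁ (qs l) t ≡ just (qs l') → walk₂ (qs' l) t ≡ just (qs' l')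
      links l l' t le h = subst₂ (λ x z → walk₂ x t ≡ just z) (e' l) (e' l')
        (LocalIso.links I l l' t le (subst₂ (λ x z → walk₁ x t ≡ just z) (sym (e l)) (sym (e l')) h))
      links' : ∀ l l' t → ∣ t ∣ ≤ r → walk₂ (qs' l) t ≡ just (qs' l') → walk₁ (qs l) t ≡ just (qs l')
      links' l l' t le h = subst₂ (λ x z → walk₁ x t ≡ just z) (e l) (e l')
        (LocalIso.links' I l l' t le (subst₂ (λ x z → walk₂ x t ≡ just z) (sym (e' l)) (sym (e' l')) h))

    module Symmetric (~sym : ∀ {x y} → x ~ y → y ~ x)
                     (~trans : ∀ {x y z} → x ~ y → y ~ z → x ~ z) where

      ≈-sym : ∀ {a b} → a ≈ b → b ≈ a
      ≈-sym {just x} {just y} e = ~sym e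
      ≈-sym {nothing} {nothing} e = tt

      ≈-trans : ∀ {a b c} → a ≈ b → b ≈ c → a ≈ c
      ≈-trans {just x} {just y} {just z} e f = ~trans e f
      ≈-trans {nothing} {nothing} {nothing} e f = tt

      LocalIso-sym : ∀ {G₁ G₂ r m ps ps'} → LocalIso G₁ G₂ r m ps ps' → LocalIso G₂ G₁ r m ps' ps
      LocalIso-sym {G₁} {G₂} {r} {m} {ps} {ps'} I =
        record { views = views ; links = LocalIso.links' I ; links' = LocalIso.links I }
        where
        views : ∀ l t → ∣ t ∣ ≤ r → Walk.walk G₂ (ps' l) t ≈ Walk.walk G₁ (ps l) t
        views l t le = ≈-sym {Walk.walk G₁ (ps l) t} (LocalIso.views I l t le)

    module Extension (G₁ G₂ : PartialSucc n)
                     (~sym : ∀ {x y} → x ~ y → y ~ x)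
                     (~trans : ∀ {x y z} → x ~ y → y ~ z → x ~ z)
                     (~dec : ∀ x y → Dec (x ~ y))
                     (Rb : ℕ)
                     (same-view : ∀ p t → ∣ t ∣ ≤ Rb → Walk.walk G₁ p t ≈ Walk.walk G₂ p t)
                     (acyclic₁ : ∀ p t → ∣ t ∣ ≤ Rb → Walk.walk G₁ p t ≡ just p → t ≡ + 0)
                     (acyclic₂ : ∀ p t → ∣ t ∣ ≤ Rb → Walk.walk G₂ p t ≡ just p → t ≡ + 0) where
      open Symmetric ~sym ~trans
      open Walk G₁ renaming (walk to walk₁; walk-+ to walk₁-+; walk-back to walk₁-back)
      open Walk G₂ renaming (walk to walk₂; walk-+ to walk₂-+; walk-back to walk₂-back)

      _≈?_ : ∀ a b → Dec (a ≈ b)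
      just x ≈? just y = ~dec x y
      just x ≈? nothing = no λ ()
      nothing ≈? just y = no λ ()
      nothing ≈? nothing = yes tt

      _≟M_ : (a b : Maybe (Fin n)) → Dec (a ≡ b)
      _≟M_ = MP.≡-dec _≟F_

      module Step {r R' m : ℕ} {ps ps' : Fin m → Fin n} (r+r≤R' : r ℕ.+ r ≤ R') (R'≤Rb : R' ≤ Rb)
                  (I : LocalIso G₁ G₂ R' m ps ps') where
        open LocalIso I

        r≤R' : r ≤ R'
        r≤R' = ℕP.≤-trans (ℕP.m≤m+n r r) r+r≤R'

        r≤Rb : r ≤ Rb
        r≤Rb = ℕP.≤-trans r≤R' R'≤Rb

        sum-bound : ∀ t s → ∣ t ∣ ≤ r → ∣ s ∣ ≤ r → ∣ t ℤ.+ s ∣ ≤ R'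
        sum-bound t s a b = ℕP.≤-trans (∣t+s∣≤r+r t s a b) r+r≤R'

        -- A new pair (p, p') may be added once p and p' look alike and are linked
        -- to old pebbles in the same way; links among the new pair are trivial by
        -- acyclicity, and links from old pebbles follow by retracing walks.
        add-pebble : ∀ p p' →
          (∀ s → ∣ s ∣ ≤ r → walk₁ p s ≈ walk₂ p' s) →
          (∀ l s → ∣ s ∣ ≤ r → walk₁ p s ≡ just (ps l) → walk₂ p' s ≡ just (ps' l)) →
          (∀ l s → ∣ s ∣ ≤ r → walk₂ p' s ≡ just (ps' l) → walk₁ p s ≡ just (ps l)) →
          LocalIso G₁ G₂ r (suc m) (extend p ps) (extend p' ps')
        add-pebble p p' view to from = record { views = views' ; links = links⁺ ; links' = links⁺' }
          where
          views' : ∀ l s → ∣ s ∣ ≤ r → walk₁ (extend p ps l) s ≈ walk₂ (extend p' ps' l) s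
          views' fz = view
          views' (fs l) s le = views l s (ℕP.≤-trans le r≤R')
          links⁺ : ∀ l l' s → ∣ s ∣ ≤ r →
                   walk₁ (extend p ps l) s ≡ just (extend p ps l') → walk₂ (extend p' ps' l) s ≡ just (extend p' ps' l')
          links⁺ fz fz s le e rewrite acyclic₁ p s (ℕP.≤-trans le r≤Rb) e = refl
          links⁺ fz (fs l) = to l
          links⁺ (fs l) fz s le e = subst (λ z → walk₂ (ps' l) z ≡ just p') (ℤP.neg-involutive s)
            (walk₂-back (- s) (to l (- s) (∣-t∣≤r s le) (walk₁-back s e)))
          links⁺ (fs l) (fs l') s le = links l l' s (ℕP.≤-trans le r≤R')
          links⁺' : ∀ l l' s → ∣ s ∣ ≤ r →
                   walk₂ (extend p' ps' l) s ≡ just (extend p' ps' l') → walk₁ (extend p ps l) s ≡ just (extend p ps l')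
          links⁺' fz fz s le e rewrite acyclic₂ p' s (ℕP.≤-trans le r≤Rb) e = refl
          links⁺' fz (fs l) = from l
          links⁺' (fs l) fz s le e = subst (λ z → walk₁ (ps l) z ≡ just p) (ℤP.neg-involutive s)
            (walk₁-back (- s) (from l (- s) (∣-t∣≤r s le) (walk₂-back s e)))
          links⁺' (fs l) (fs l') s le = links' l l' s (ℕP.≤-trans le r≤R')

        Near₁ : Fin n → Set
        Near₁ p = Σ (Fin m) λ l → BEx r (λ t → walk₁ (ps l) t ≡ just p)

        Near₂ : Fin n → Set
        Near₂ q = Σ (Fin m) λ l → BEx r (λ u → walk₂ (ps' l) u ≡ just q)

        -- A point near pebble l is answered by walking the same way from its partner.
        answer-near : ∀ p → Near₁ p → Σ (Fin n) λ p' → LocalIso G₁ G₂ r (suc m) (extend p ps) (extend p' ps')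
        answer-near p (l , t , t≤r , e)
          with ≈-justʳ (walk₂ (ps' l) t) (subst (_≈ walk₂ (ps' l) t) e (views l t (ℕP.≤-trans t≤r r≤R')))
        ... | p' , e' = p' , add-pebble p p' view to from
          where
          view : ∀ s → ∣ s ∣ ≤ r → walk₁ p s ≈ walk₂ p' s
          view s le = subst₂ _≈_ (sym (walk₁-+ t s e)) (sym (walk₂-+ t s e')) (views l (t ℤ.+ s) (sum-bound t s t≤r le))
          to : ∀ l' s → ∣ s ∣ ≤ r → walk₁ p s ≡ just (ps l') → walk₂ p' s ≡ just (ps' l')
          to l' s le h = trans (walk₂-+ t s e') (links l l' (t ℤ.+ s) (sum-bound t s t≤r le) (trans (sym (walk₁-+ t s e)) h))
          from : ∀ l' s → ∣ s ∣ ≤ r → walk₂ p' s ≡ just (ps' l') → walk₁ p s ≡ just (ps l')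
          from l' s le h = trans (walk₁-+ t s e) (links' l l' (t ℤ.+ s) (sum-bound t s t≤r le) (trans (sym (walk₂-+ t s e')) h))

        SameView : Fin n → Fin n → Set
        SameView p q = BAll r (λ s → walk₂ q s ≈ walk₁ p s)

        counterpart : ∀ {q} → Near₂ q → Fin n
        counterpart (l , u , u≤r , e) = proj₁ (≈-justˡ (walk₁ (ps l) u) (views l u (ℕP.≤-trans u≤r r≤R')) e)

        counterpart-walk : ∀ {q} (w : Near₂ q) → walk₁ (ps (proj₁ w)) (proj₁ (proj₂ w)) ≡ just (counterpart w)
        counterpart-walk (l , u , u≤r , e) = proj₂ (≈-justˡ (walk₁ (ps l) u) (views l u (ℕP.≤-trans u≤r r≤R')) e)

        near₁? : ∀ p → Dec (Near₁ p)
        near₁? p = any? (λ l → bex? r (λ t → walk₁ (ps l) t ≟M just p))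

        near₂? : ∀ q → Dec (Near₂ q)
        near₂? q = any? (λ l → bex? r (λ u → walk₂ (ps' l) u ≟M just q))

        sameView? : ∀ p q → Dec (SameView p q)
        sameView? p q = ball? r (λ s → walk₂ q s ≈? walk₁ p s)

        -- The counterpart of a point looking like p in G₂ also looks like p: its view
        -- in G₁ is its view in G₂, which is seen from the pebble within radius r + r.
        counterpart-view : ∀ p {q} → SameView p q → (w : Near₂ q) → SameView p (counterpart w)
        counterpart-view p v w@(l , u , u≤r , e) s le =
          ≈-trans {walk₂ x s} {walk₁ x s} (≈-sym {walk₁ x s} (same-view x s (ℕP.≤-trans le r≤Rb)))
            (subst (_≈ walk₁ p s) (sym (walk₁-+ u s (counterpart-walk w)))
              (≈-trans {walk₁ (ps l) (u ℤ.+ s)} {walk₂ (ps' l) (u ℤ.+ s)}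
                (views l (u ℤ.+ s) (sum-bound u s u≤r le))
                (subst (_≈ walk₁ p s) (walk₂-+ u s e) (v s le))))
          where
          x : Fin n
          x = counterpart w

        counterpart-near : ∀ {q} (w : Near₂ q) → Near₁ (counterpart w)
        counterpart-near w@(l , u , u≤r , e) = l , u , u≤r , counterpart-walk w

        -- Distinct points have distinct counterparts: if the counterparts coincide,
        -- the pebbles l₁, l₂ are joined by the walk u₁ - u₂ in G₁, hence so are their
        -- partners in G₂, and both walks in G₂ end at the same point.
        counterpart-injective : ∀ {q₁ q₂} (w₁ : Near₂ q₁) (w₂ : Near₂ q₂) → counterpart w₁ ≡ counterpart w₂ → q₁ ≡ q₂
        counterpart-injective w₁@(l₁ , u₁ , le₁ , e₁) w₂@(l₂ , u₂ , le₂ , e₂) eq =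
          sym (MP.just-injective (trans (sym e₂) (trans same-end e₁)))
          where
          joined₁ : walk₁ (ps l₁) (u₁ ℤ.+ - u₂) ≡ just (ps l₂)
          joined₁ = trans (sym (walk₁-+ u₁ (- u₂) (trans (counterpart-walk w₁) (cong just eq))))
                          (walk₁-back u₂ (counterpart-walk w₂))
          joined₂ : walk₂ (ps' l₁) (u₁ ℤ.+ - u₂) ≡ just (ps' l₂)
          joined₂ = links l₁ l₂ (u₁ ℤ.+ - u₂) (sum-bound u₁ (- u₂) le₁ (∣-t∣≤r u₂ le₂)) joined₁
          same-end : walk₂ (ps' l₂) u₂ ≡ walk₂ (ps' l₁) u₁
          same-end = trans (walk₂-+ (u₁ ℤ.+ - u₂) u₂ joined₂) (cong (walk₂ (ps' l₁)) (t-s+s≡t u₁ u₂))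

        -- A far point p has a partner p' with the same view and far from all pebbles:
        -- otherwise every look-alike of p in G₂ is near a pebble, and `counterpart`
        -- injects the look-alikes of p into the look-alikes of p other than p.
        far-partner : ∀ p → ¬ Near₁ p → Σ (Fin n) λ p' → SameView p p' × ¬ Near₂ p'
        far-partner p far with any? (λ q → sameView? p q ×-dec ¬? (near₂? q))
        ... | yes found = found
        ... | no none = ⊥-elim (no-injection-missing-a-point (SameView p) (sameView? p) p p-looks-like-p
            (λ q v → counterpart (near q v))
            (λ q v → counterpart-view p v (near q v))
            (λ q v eq → far (subst Near₁ eq (counterpart-near (near q v))))
            (λ q₁ q₂ v₁ v₂ → counterpart-injective (near q₁ v₁) (near q₂ v₂)))
          where
          p-looks-like-p : SameView p p
          p-looks-like-p s le = ≈-sym {walk₁ p s} (same-view p s (ℕP.≤-trans le r≤Rb))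
          near : ∀ q → SameView p q → Near₂ q
          near q v with near₂? q
          ... | yes w = w
          ... | no ¬w = ⊥-elim (none (q , v , ¬w))

        answer-far : ∀ p → ¬ Near₁ p → Σ (Fin n) λ p' → LocalIso G₁ G₂ r (suc m) (extend p ps) (extend p' ps')
        answer-far p far with far-partner p far
        ... | p' , v , far' = p' , add-pebble p p' (λ s le → ≈-sym {walk₂ p' s} (v s le))
          (λ l s le e → ⊥-elim (far (l , - s , ∣-t∣≤r s le , walk₁-back s e)))
          (λ l s le e → ⊥-elim (far' (l , - s , ∣-t∣≤r s le , walk₂-back s e)))

      extend-iso : ∀ r R' {m} {ps ps' : Fin m → Fin n} → r ℕ.+ r ≤ R' → R' ≤ Rb → LocalIso G₁ G₂ R' m ps ps' →
                   ∀ p → Σ (Fin n) λ p' → LocalIso G₁ G₂ r (suc m) (extend p ps) (extend p' ps')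
      extend-iso r R' rr R'≤Rb I p with Step.near₁? rr R'≤Rb I p
      ... | yes near = Step.answer-near rr R'≤Rb I p near
      ... | no far = Step.answer-far rr R'≤Rb I p far

module BackAndForth where

  open import Data.Nat as ℕ using (ℕ; zero; suc; _≤_; _⊔_; s≤s)
  import Data.Nat.Properties as ℕP
  open import Data.Fin using (Fin; _≟_) renaming (zero to fz; suc to fs)
  open import Data.Bool using (Bool; true; false; _∧_; _∨_; not)
  open import Data.Product using (Σ; _×_; _,_; proj₁; proj₂)
  open import Relation.Nullary.Decidable using (⌊_⌋)
  open import Relation.Binary.PropositionalEquality
  open import Defs

  rank : ∀ {k n} → Formula k n → ℕ
  rank (rel _ _ _) = 0
  rank (un _ _) = 0
  rank (eq _ _) = 0
  rank (neg φ) = rank φ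
  rank (and φ ψ) = rank φ ⊔ rank ψ
  rank (or φ ψ) = rank φ ⊔ rank ψ
  rank (all φ) = suc (rank φ)
  rank (ex φ) = suc (rank φ)

  true-iff : ∀ {x y : Bool} → (x ≡ true → y ≡ true) → (y ≡ true → x ≡ true) → x ≡ y
  true-iff {false} {false} f g = refl
  true-iff {false} {true} f g = g refl
  true-iff {true} {false} f g = sym (f refl)
  true-iff {true} {true} f g = refl

  ∧-true : ∀ {x y} → x ∧ y ≡ true → x ≡ true × y ≡ true
  ∧-true {true} {true} e = refl , refl

  allᵇ-true : ∀ {m} (f : Fin m → Bool) → allᵇ f ≡ true → ∀ a → f a ≡ true
  allᵇ-true {suc m} f e fz = proj₁ (∧-true {f fz} e)
  allᵇ-true {suc m} f e (fs a) = allᵇ-true (λ i → f (fs i)) (proj₂ (∧-true {f fz} e)) a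

  true-allᵇ : ∀ {m} (f : Fin m → Bool) → (∀ a → f a ≡ true) → allᵇ f ≡ true
  true-allᵇ {zero} f h = refl
  true-allᵇ {suc m} f h rewrite h fz = true-allᵇ (λ i → f (fs i)) (λ a → h (fs a))

  anyᵇ-true : ∀ {m} (f : Fin m → Bool) → anyᵇ f ≡ true → Σ (Fin m) λ a → f a ≡ true
  anyᵇ-true {suc m} f e with f fz in eq
  ... | true = fz , eq
  ... | false = let a , h = anyᵇ-true (λ i → f (fs i)) e in fs a , h

  true-anyᵇ : ∀ {m} (f : Fin m → Bool) a → f a ≡ true → anyᵇ f ≡ true
  true-anyᵇ {suc m} f fz h rewrite h = refl
  true-anyᵇ {suc m} f (fs a) h with f fz
  ... | true = refl
  ... | false = true-anyᵇ (λ i → f (fs i)) a h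

  module _ {m₁ m₂ : ℕ} (f : Fin m₁ → Bool) (f' : Fin m₂ → Bool)
           (forth : ∀ a → Σ (Fin m₂) λ b → f a ≡ f' b) (back : ∀ b → Σ (Fin m₁) λ a → f a ≡ f' b) where
    allᵇ-cong : allᵇ f ≡ allᵇ f'
    allᵇ-cong = true-iff (λ e → true-allᵇ f' (λ b → let a , h = back b in trans (sym h) (allᵇ-true f e a)))
                         (λ e → true-allᵇ f (λ a → let b , h = forth a in trans h (allᵇ-true f' e b)))
    anyᵇ-cong : anyᵇ f ≡ anyᵇ f'
    anyᵇ-cong = true-iff (λ e → let a , h = anyᵇ-true f e ; b , h' = forth a in true-anyᵇ f' b (trans (sym h') h))
                         (λ e → let b , h = anyᵇ-true f' e ; a , h' = back b in true-anyᵇ f a (trans h' h))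

  -- Z g m ρ σ: the assignments ρ, σ of m variables are linked with g rounds left.
  module Soundness {k : ℕ} (M B : Structure k)
    (Z : ℕ → (m : ℕ) → (Fin m → Fin (size M)) → (Fin m → Fin (size B)) → Set)
    (atom-rel : ∀ {g m ρ σ} → Z g m ρ σ → ∀ s i j → relOf M s (ρ i) (ρ j) ≡ relOf B s (σ i) (σ j))
    (atom-un : ∀ {g m ρ σ} → Z g m ρ σ → ∀ u i → unOf M u (ρ i) ≡ unOf B u (σ i))
    (atom-eq : ∀ {g m ρ σ} → Z g m ρ σ → ∀ i j → ⌊ ρ i ≟ ρ j ⌋ ≡ ⌊ σ i ≟ σ j ⌋)
    (forth : ∀ {g m ρ σ} → Z (suc g) m ρ σ → ∀ a → Σ (Fin (size B)) λ b → Z g (suc m) (extend a ρ) (extend b σ))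
    (back : ∀ {g m ρ σ} → Z (suc g) m ρ σ → ∀ b → Σ (Fin (size M)) λ a → Z g (suc m) (extend a ρ) (extend b σ)) where

    same-truth : ∀ {m} (φ : Formula k m) g {ρ σ} → rank φ ≤ g → Z g m ρ σ → eval M φ ρ ≡ eval B φ σ
    same-truth (rel s i j) g le z = atom-rel z s i j
    same-truth (un u i) g le z = atom-un z u i
    same-truth (eq i j) g le z = atom-eq z i j
    same-truth (neg φ) g le z = cong not (same-truth φ g le z)
    same-truth (and φ ψ) g le z =
      cong₂ _∧_ (same-truth φ g (ℕP.m⊔n≤o⇒m≤o _ _ le) z) (same-truth ψ g (ℕP.m⊔n≤o⇒n≤o _ _ le) z)
    same-truth (or φ ψ) g le z =
      cong₂ _∨_ (same-truth φ g (ℕP.m⊔n≤o⇒m≤o _ _ le) z) (same-truth ψ g (ℕP.m⊔n≤o⇒n≤o _ _ le) z)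
    same-truth (all φ) (suc g) {ρ} {σ} (s≤s le) z =
      allᵇ-cong (λ a → eval M φ (extend a ρ)) (λ b → eval B φ (extend b σ))
        (λ a → let b , z' = forth z a in b , same-truth φ g le z')
        (λ b → let a , z' = back z b in a , same-truth φ g le z')
    same-truth (ex φ) (suc g) {ρ} {σ} (s≤s le) z =
      anyᵇ-cong (λ a → eval M φ (extend a ρ)) (λ b → eval B φ (extend b σ))
        (λ a → let b , z' = forth z a in b , same-truth φ g le z')
        (λ b → let a , z' = back z b in a , same-truth φ g le z')

module Lines where

  open import Data.Nat as ℕ using (ℕ; zero; suc; _<_; _<?_)
  import Data.Nat.Properties as ℕP
  open import Data.Integer using (+_; -[1+_])
  open import Data.Fin using (Fin; toℕ; fromℕ<)
  open import Data.Fin.Properties using (toℕ-fromℕ<; toℕ-injective; toℕ<n)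
  open import Data.Maybe using (Maybe; just; nothing; _>>=_)
  open import Data.Product using (Σ; _×_; _,_)
  open import Data.Empty using (⊥-elim)
  open import Relation.Nullary using (yes; no)
  open import Relation.Binary.PropositionalEquality
  open Walks

  module OnFin (n : ℕ) where

    fin : ℕ → Maybe (Fin n)
    fin m with m <? n
    ... | yes lt = just (fromℕ< lt)
    ... | no _ = nothing

    fin-just : ∀ m {q} → fin m ≡ just q → toℕ q ≡ m
    fin-just m e with m <? n
    fin-just m refl | yes lt = toℕ-fromℕ< lt

    fin-toℕ : ∀ q → fin (toℕ q) ≡ just q
    fin-toℕ q with toℕ q <? n
    ... | yes lt = cong just (toℕ-injective (toℕ-fromℕ< lt))
    ... | no ¬lt = ⊥-elim (¬lt (toℕ<n q))

    fin-< : ∀ m → m < n → Σ (Fin n) λ q → fin m ≡ just q × toℕ q ≡ m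
    fin-< m lt with m <? n
    ... | yes lt' = fromℕ< lt' , refl , toℕ-fromℕ< lt'
    ... | no ¬lt = ⊥-elim (¬lt lt)

    restrict : (σ : ℕ → ℕ) (τ : ℕ → Maybe ℕ) →
               (∀ {x y} → σ x ≡ y → τ y ≡ just x) → (∀ {x y} → τ y ≡ just x → σ x ≡ y) → PartialSucc n
    restrict σ τ στ τσ = record { next = next ; prev = prev ; next→prev = next→prev ; prev→next = prev→next }
      where
      next : Fin n → Maybe (Fin n)
      next p = fin (σ (toℕ p))
      prev : Fin n → Maybe (Fin n)
      prev q = τ (toℕ q) >>= fin
      next→prev : ∀ {p q} → next p ≡ just q → prev q ≡ just p
      next→prev {p} e rewrite στ (sym (fin-just _ e)) = fin-toℕ p
      prev→next : ∀ {p q} → prev p ≡ just q → next q ≡ just p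
      prev→next {p} e with >>=-just (τ (toℕ p)) fin e
      ... | x , e₁ , e₂ rewrite fin-just x e₂ | τσ e₁ = fin-toℕ p

    pred? : ℕ → Maybe ℕ
    pred? zero = nothing
    pred? (suc y) = just y

    straight : PartialSucc n
    straight = restrict suc pred? (λ { refl → refl }) (λ { {y = suc y} refl → refl })

    open PartialSucc straight
    open Walk straight

    straight-next : ∀ {x x'} → next x ≡ just x' → toℕ x' ≡ suc (toℕ x)
    straight-next {x} = fin-just (suc (toℕ x))

    straight-next⁻¹ : ∀ {x x'} → toℕ x' ≡ suc (toℕ x) → next x ≡ just x'
    straight-next⁻¹ {x} {x'} e = subst (λ z → fin z ≡ just x') e (fin-toℕ x')

    straight-forwards : ∀ m p {q} → iterate next m p ≡ just q → toℕ q ≡ toℕ p ℕ.+ m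
    straight-forwards zero p refl = sym (ℕP.+-identityʳ _)
    straight-forwards (suc m) p e with >>=-just (iterate next m p) next e
    ... | r , e₁ , e₂ rewrite fin-just _ e₂ | straight-forwards m p e₁ = sym (ℕP.+-suc _ m)

    straight-backwards : ∀ m p {q} → iterate prev m p ≡ just q → toℕ q ℕ.+ m ≡ toℕ p
    straight-backwards zero p refl = ℕP.+-identityʳ _
    straight-backwards (suc m) p e with >>=-just (iterate prev m p) prev e
    ... | r , e₁ , e₂ with >>=-just (pred? (toℕ r)) fin e₂
    ... | x , e₃ , e₄ with toℕ r in er
    straight-backwards (suc m) p e | r , e₁ , e₂ | x , refl , e₄ | suc x' rewrite fin-just _ e₄ =
      trans (ℕP.+-suc x m) (trans (cong (ℕ._+ m) (sym er)) (straight-backwards m p e₁))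

    straight-acyclic : ∀ p t → walk p t ≡ just p → t ≡ + 0
    straight-acyclic p (+ m) e =
      cong +_ (ℕP.+-cancelˡ-≡ (toℕ p) m 0 (trans (sym (straight-forwards m p e)) (sym (ℕP.+-identityʳ _))))
    straight-acyclic p -[1+ m ] e = ⊥-elim (ℕP.m+1+n≢m (toℕ p) (straight-backwards (suc m) p e))

-- The twisted line: the straight line on Fin n with the successors of a and of
-- b = a + c exchanged, so that a → b+1 and b → a+1.  If c > r + 1 and the window
-- of radius r around a+1 sits well inside Fin n, then walks of length ≤ r from a
-- common start stay, in the two lines, either equal or exactly c apart within
-- that window.  Hence the twisted line has no short cycles and, when labels in
-- the window repeat with period c, looks locally like the straight line; yet it
-- contains the cycle a+1 → … → b → a+1 of length c.
module Twisted where

  open import Data.Nat as ℕ using (ℕ; zero; suc; _≤_; _<_; z≤n; s≤s; _≟_)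
  import Data.Nat.Properties as ℕP
  open import Data.Integer using (+_; -[1+_]; ∣_∣)
  open import Data.Fin using (Fin; toℕ)
  open import Data.Fin.Properties using (toℕ-injective; toℕ<n)
  open import Data.Maybe using (Maybe; just; nothing; _>>=_)
  open import Data.Product using (Σ; _×_; _,_; proj₁; proj₂)
  open import Data.Unit using (⊤; tt)
  open import Data.Empty using (⊥; ⊥-elim)
  open import Relation.Nullary using (yes; no)
  open import Relation.Binary.PropositionalEquality
  open import Algebra.Properties.CommutativeSemigroup ℕP.+-commutativeSemigroup using (xy∙z≈xz∙y)
  open Walks
  open Lines
  open LocalIsos using (module Labelled)

  module At (n a c r : ℕ) (r+2≤c : suc (suc r) ≤ c) (r≤a : r ≤ a)
               (room : suc (suc (a ℕ.+ c ℕ.+ r)) ≤ n) where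
    open OnFin n

    b : ℕ
    b = a ℕ.+ c

    c≥1 : 1 ≤ c
    c≥1 = ℕP.≤-trans (s≤s z≤n) r+2≤c

    a≢b : a ≢ b
    a≢b e = ℕP.<⇒≢ c≥1 (ℕP.+-cancelˡ-≡ a 0 c (trans (ℕP.+-identityʳ a) e))

    swap : ℕ → ℕ
    swap x with x ≟ a | x ≟ b
    ... | yes _ | _ = b
    ... | no _ | yes _ = a
    ... | no _ | no _ = x

    swap-a : swap a ≡ b
    swap-a with a ≟ a
    ... | yes _ = refl
    ... | no ne = ⊥-elim (ne refl)

    swap-b : swap b ≡ a
    swap-b with b ≟ a | b ≟ b
    ... | yes e | _ = ⊥-elim (a≢b (sym e))
    ... | no _ | yes _ = refl
    ... | no _ | no ne = ⊥-elim (ne refl)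

    swap-other : ∀ x → x ≢ a → x ≢ b → swap x ≡ x
    swap-other x na nb with x ≟ a | x ≟ b
    ... | yes e | _ = ⊥-elim (na e)
    ... | no _ | yes e = ⊥-elim (nb e)
    ... | no _ | no _ = refl

    swap-involutive : ∀ x → swap (swap x) ≡ x
    swap-involutive x with x ≟ a | x ≟ b
    ... | yes refl | _ = swap-b
    ... | no _ | yes refl = swap-a
    ... | no na | no nb = swap-other x na nb

    twisted-pred : ℕ → Maybe ℕ
    twisted-pred zero = nothing
    twisted-pred (suc y) = just (swap y)

    twisted : PartialSucc n
    twisted = restrict (λ x → suc (swap x)) twisted-pred
      (λ { {x} refl → cong just (swap-involutive x) })
      (λ { {y = suc y} refl → cong suc (swap-involutive y) })

    open PartialSucc using (next; prev)
    open Walk straight using () renaming (walk to walk₁)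
    open Walk twisted using () renaming (walk to walk₂)

    -- Centre of the window in which the two lines may disagree.
    i : ℕ
    i = suc a

    -- Relation between positions x (straight) and y (twisted) after k steps from a
    -- common start: equal, or c apart with the smaller within distance k of i.
    data Sim (k x y : ℕ) : Set where
      same : x ≡ y → Sim k x y
      ahead : y ≡ x ℕ.+ c → i ≤ x ℕ.+ k → x ≤ i ℕ.+ k → Sim k x y
      behind : x ≡ y ℕ.+ c → i ≤ y ℕ.+ k → y ≤ i ℕ.+ k → Sim k x y

    SimM : ℕ → Maybe (Fin n) → Maybe (Fin n) → Set
    SimM k (just q₁) (just q₂) = Sim k (toℕ q₁) (toℕ q₂)
    SimM k nothing nothing = ⊤
    SimM k _ _ = ⊥

    sim-same : ∀ k {x y} → x ≡ y → SimM k (fin x) (fin y)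
    sim-same k {x} refl with fin x
    ... | just q = same refl
    ... | nothing = tt

    sim-fin : ∀ k {x y} → Sim k x y → x < n → y < n → SimM k (fin x) (fin y)
    sim-fin k {x} {y} s x<n y<n with fin-< x x<n | fin-< y y<n
    ... | q₁ , e₁ , v₁ | q₂ , e₂ , v₂ rewrite e₁ | e₂ | v₁ | v₂ = s

    open ℕP.≤-Reasoning

    shifted<n : ∀ k → suc k ≤ r → ∀ z → z ≤ i ℕ.+ k → suc (z ℕ.+ c) < n
    shifted<n k k<r z z≤ = begin
      suc (suc (z ℕ.+ c))             ≤⟨ s≤s (s≤s (ℕP.+-monoˡ-≤ c z≤)) ⟩
      suc (suc (suc (a ℕ.+ k ℕ.+ c))) ≡⟨ cong (λ w → suc (suc (suc w))) (xy∙z≈xz∙y a k c) ⟩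
      suc (suc (suc (a ℕ.+ c ℕ.+ k))) ≡⟨ cong (λ w → suc (suc w)) (sym (ℕP.+-suc (a ℕ.+ c) k)) ⟩
      suc (suc (a ℕ.+ c ℕ.+ suc k))   ≤⟨ s≤s (s≤s (ℕP.+-monoʳ-≤ (a ℕ.+ c) k<r)) ⟩
      suc (suc (a ℕ.+ c ℕ.+ r))       ≤⟨ room ⟩
      n ∎

    b<n : b < n
    b<n = ℕP.≤-trans (s≤s (ℕP.≤-trans (ℕP.m≤m+n b r) (ℕP.n≤1+n _))) room

    1+b<n : suc b < n
    1+b<n = ℕP.≤-trans (s≤s (s≤s (ℕP.m≤m+n b r))) room

    1+a<n : suc a < n
    1+a<n = ℕP.≤-trans (s≤s (s≤s (ℕP.m≤m+n a c))) 1+b<n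

    a<n : a < n
    a<n = ℕP.≤-<-trans (ℕP.m≤m+n a c) b<n

    k<c : ∀ {k} → k ≤ r → k < c
    k<c k≤r = ℕP.≤-trans (s≤s k≤r) (ℕP.≤-trans (ℕP.n≤1+n _) r+2≤c)

    1+k<c : ∀ {k} → k ≤ r → suc k < c
    1+k<c k≤r = ℕP.≤-trans (s≤s (s≤s k≤r)) r+2≤c

    below-window : ∀ {x k} → suc a ≤ suc x ℕ.+ k → k < c → x ℕ.+ c ≢ a
    below-window {x} lo k<c' e = ℕP.<-irrefl (sym e) (ℕP.≤-<-trans (ℕP.≤-pred lo) (ℕP.+-monoʳ-< x k<c'))

    above-window : ∀ {k} → b ≤ suc a ℕ.+ k → suc k < c → ⊥
    above-window {k} hi k<c' =
      ℕP.<⇒≱ k<c' (ℕP.+-cancelˡ-≤ a c (suc k) (ℕP.≤-trans hi (ℕP.≤-reflexive (sym (ℕP.+-suc a k)))))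

    window-above-0 : ∀ {k} → suc a ≤ k → k ≤ r → ⊥
    window-above-0 lo k≤r = ℕP.<-irrefl refl (ℕP.≤-trans lo (ℕP.≤-trans k≤r r≤a))

    lo-next : ∀ {x k} → i ≤ x ℕ.+ k → i ≤ suc x ℕ.+ suc k
    lo-next {x} {k} lo = ℕP.≤-trans lo (ℕP.≤-trans (ℕP.n≤1+n _) (s≤s (ℕP.+-monoʳ-≤ x (ℕP.n≤1+n k))))
    hi-next : ∀ {x k} → x ≤ i ℕ.+ k → suc x ≤ i ℕ.+ suc k
    hi-next {x} {k} hi = ℕP.≤-trans (s≤s hi) (ℕP.≤-reflexive (cong suc (sym (ℕP.+-suc a k))))
    lo-prev : ∀ {x k} → i ≤ suc x ℕ.+ k → i ≤ x ℕ.+ suc k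
    lo-prev {x} {k} lo = ℕP.≤-trans lo (ℕP.≤-reflexive (sym (ℕP.+-suc x k)))
    hi-prev : ∀ {x k} → suc x ≤ i ℕ.+ k → x ≤ i ℕ.+ suc k
    hi-prev {x} {k} hi = ℕP.≤-trans (ℕP.n≤1+n x) (ℕP.≤-trans hi (ℕP.+-monoʳ-≤ i (ℕP.n≤1+n k)))
    lo-a : ∀ k → i ≤ a ℕ.+ suc k
    lo-a k = ℕP.≤-trans (s≤s (ℕP.m≤m+n a k)) (ℕP.≤-reflexive (sym (ℕP.+-suc a k)))
    hi-a : ∀ k → a ≤ i ℕ.+ suc k
    hi-a k = ℕP.≤-trans (ℕP.n≤1+n a) (ℕP.m≤m+n i (suc k))

    pred<n : ∀ {x} → suc x < n → x < n
    pred<n x<n = ℕP.<-trans (ℕP.n<1+n _) x<n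

    sim-next : ∀ k x y → suc k ≤ r → x < n → y < n → Sim k x y →
               SimM (suc k) (fin (suc x)) (fin (suc (swap y)))
    sim-next k x .x k<r x<n y<n (same refl) with x ≟ a | x ≟ b
    ... | yes refl | _ = sim-fin (suc k) (ahead refl (ℕP.m≤m+n _ _) (ℕP.m≤m+n _ _)) 1+a<n 1+b<n
    ... | no _ | yes refl = sim-fin (suc k) (behind refl (ℕP.m≤m+n _ _) (ℕP.m≤m+n _ _)) 1+b<n 1+a<n
    ... | no _ | no _ = sim-same (suc k) refl
    sim-next k x y k<r x<n y<n (ahead e lo hi) with y ≟ a | y ≟ b
    ... | yes refl | _ = ⊥-elim (ℕP.<-irrefl e (ℕP.<-≤-trans lo (ℕP.+-monoʳ-≤ x (ℕP.<⇒≤ (k<c (ℕP.<⇒≤ k<r))))))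
    ... | no _ | yes refl = sim-same (suc k) (cong suc (ℕP.+-cancelʳ-≡ c x a (sym e)))
    ... | no _ | no _ rewrite e = sim-fin (suc k) (ahead refl (lo-next lo) (hi-next hi))
      (ℕP.≤-<-trans (s≤s (ℕP.m≤m+n x c)) (shifted<n k k<r x hi)) (shifted<n k k<r x hi)
    sim-next k x y k<r x<n y<n (behind e lo hi) with y ≟ a | y ≟ b
    ... | yes refl | _ = sim-same (suc k) (cong suc e)
    ... | no _ | yes refl = ⊥-elim (above-window hi (1+k<c (ℕP.<⇒≤ k<r)))
    ... | no _ | no _ rewrite e = sim-fin (suc k) (behind refl (lo-next lo) (hi-next hi))
      (shifted<n k k<r y hi) (ℕP.≤-<-trans (s≤s (ℕP.m≤m+n y c)) (shifted<n k k<r y hi))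

    sim-prev : ∀ k x y → suc k ≤ r → x < n → y < n → Sim k x y →
               SimM (suc k) (pred? x >>= fin) (twisted-pred y >>= fin)
    sim-prev k zero .zero k<r x<n y<n (same refl) = tt
    sim-prev k (suc z) .(suc z) k<r x<n y<n (same refl) with z ≟ a | z ≟ b
    ... | yes refl | _ = sim-fin (suc k) (ahead refl (lo-a k) (hi-a k)) (pred<n x<n) b<n
    ... | no _ | yes refl = sim-fin (suc k) (behind refl (lo-a k) (hi-a k)) (pred<n x<n) a<n
    ... | no _ | no _ = sim-same (suc k) refl
    sim-prev k zero y k<r x<n y<n (ahead e lo hi) = ⊥-elim (window-above-0 lo (ℕP.<⇒≤ k<r))
    sim-prev k (suc x) .(suc x ℕ.+ c) k<r x<n y<n (ahead refl lo hi) with x ℕ.+ c ≟ a | x ℕ.+ c ≟ b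
    ... | yes e | _ = ⊥-elim (below-window lo (k<c (ℕP.<⇒≤ k<r)) e)
    ... | no _ | yes e = sim-same (suc k) (ℕP.+-cancelʳ-≡ c x a e)
    ... | no _ | no _ = sim-fin (suc k) (ahead refl (lo-prev lo) (hi-prev hi))
      (ℕP.≤-<-trans (ℕP.m≤m+n x c) (pred<n y<n)) (pred<n y<n)
    sim-prev k x zero k<r x<n y<n (behind e lo hi) = ⊥-elim (window-above-0 lo (ℕP.<⇒≤ k<r))
    sim-prev k .(suc y ℕ.+ c) (suc y) k<r x<n y<n (behind refl lo hi) with y ≟ a | y ≟ b
    ... | yes refl | _ = sim-same (suc k) refl
    ... | no _ | yes refl = ⊥-elim (ℕP.<⇒≱ (k<c (ℕP.<⇒≤ k<r)) (ℕP.+-cancelˡ-≤ a c k (ℕP.≤-pred hi)))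
    ... | no _ | no _ = sim-fin (suc k) (behind refl (lo-prev lo) (hi-prev hi))
      (pred<n x<n) (ℕP.≤-<-trans (ℕP.m≤m+n y c) (pred<n x<n))

    sim-forwards : ∀ m p → m ≤ r → SimM m (iterate (next straight) m p) (iterate (next twisted) m p)
    sim-forwards zero p _ = same refl
    sim-forwards (suc m) p m<r = step (iterate (next straight) m p) (iterate (next twisted) m p)
                                      (sim-forwards m p (ℕP.<⇒≤ m<r))
      where
      step : ∀ X Y → SimM m X Y → SimM (suc m) (X >>= next straight) (Y >>= next twisted)
      step (just q₁) (just q₂) s = sim-next m (toℕ q₁) (toℕ q₂) m<r (toℕ<n q₁) (toℕ<n q₂) s
      step nothing nothing _ = tt

    sim-backwards : ∀ m p → m ≤ r → SimM m (iterate (prev straight) m p) (iterate (prev twisted) m p)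
    sim-backwards zero p _ = same refl
    sim-backwards (suc m) p m<r = step (iterate (prev straight) m p) (iterate (prev twisted) m p)
                                       (sim-backwards m p (ℕP.<⇒≤ m<r))
      where
      step : ∀ X Y → SimM m X Y → SimM (suc m) (X >>= prev straight) (Y >>= prev twisted)
      step (just q₁) (just q₂) s = sim-prev m (toℕ q₁) (toℕ q₂) m<r (toℕ<n q₁) (toℕ<n q₂) s
      step nothing nothing _ = tt

    -- A closed walk of length m ≤ r in the twisted line has a straight counterpart
    -- from p to a point Sim-related to p, which forces m = 0.
    closed-forwards : ∀ m p → m ≤ r → (X : Maybe (Fin n)) → iterate (next straight) m p ≡ X →
                      SimM m X (just p) → m ≡ 0
    closed-forwards m p m≤r (just q) e s with straight-forwards m p e | s
    ... | q≡p+m | same e' = ℕP.+-cancelˡ-≡ (toℕ p) m 0 (trans (sym q≡p+m) (trans e' (sym (ℕP.+-identityʳ _))))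
    ... | q≡p+m | ahead e' _ _ = ⊥-elim (ℕP.<-irrefl e' (ℕP.≤-<-trans
          (ℕP.≤-trans (ℕP.m≤m+n (toℕ p) m) (ℕP.≤-reflexive (sym q≡p+m))) (ℕP.m<m+n (toℕ q) c≥1)))
    ... | q≡p+m | behind e' _ _ = ⊥-elim (ℕP.<-irrefl (ℕP.+-cancelˡ-≡ (toℕ p) m c (trans (sym q≡p+m) e')) (k<c m≤r))

    closed-backwards : ∀ m p → suc m ≤ r → (X : Maybe (Fin n)) → iterate (prev straight) (suc m) p ≡ X →
                       SimM (suc m) X (just p) → ⊥
    closed-backwards m p m<r (just q) e s with straight-backwards (suc m) p e | s
    ... | q+m≡p | same e' = ℕP.m+1+n≢m (toℕ p) (trans (cong (ℕ._+ suc m) (sym e')) q+m≡p)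
    ... | q+m≡p | ahead e' _ _ = ℕP.<-irrefl (ℕP.+-cancelˡ-≡ (toℕ q) (suc m) c (trans q+m≡p e')) (k<c m<r)
    ... | q+m≡p | behind e' _ _ = ℕP.<-irrefl refl (ℕP.<-≤-trans
          (ℕP.<-≤-trans (ℕP.m<m+n (toℕ p) c≥1) (ℕP.≤-reflexive (sym e')))
          (ℕP.≤-trans (ℕP.m≤m+n (toℕ q) (suc m)) (ℕP.≤-reflexive q+m≡p)))

    twisted-acyclic : ∀ p t → ∣ t ∣ ≤ r → walk₂ p t ≡ just p → t ≡ + 0
    twisted-acyclic p (+ m) m≤r e = cong +_ (closed-forwards m p m≤r _ refl
      (subst (SimM m (iterate (next straight) m p)) e (sim-forwards m p m≤r)))
    twisted-acyclic p -[1+ m ] m<r e = ⊥-elim (closed-backwards m p m<r _ refl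
      (subst (SimM (suc m) (iterate (prev straight) (suc m) p)) e (sim-backwards (suc m) p m<r)))

    cycle-start : Fin n
    cycle-start = proj₁ (fin-< (suc a) 1+a<n)

    cycle-start-value : toℕ cycle-start ≡ suc a
    cycle-start-value = proj₂ (proj₂ (fin-< (suc a) 1+a<n))

    inside-fixed : ∀ d → suc d < c → swap (suc a ℕ.+ d) ≡ suc a ℕ.+ d
    inside-fixed d d<c = swap-other (suc a ℕ.+ d) (λ e → ℕP.m≢1+m+n a (sym e))
      (λ e → ℕP.<-irrefl (ℕP.+-cancelˡ-≡ a (suc d) c (trans (ℕP.+-suc a d) e)) d<c)

    inside<n : ∀ d → suc d < c → suc (suc a ℕ.+ d) < n
    inside<n d d<c = ℕP.≤-<-trans (ℕP.≤-trans (ℕP.≤-reflexive (sym (trans (ℕP.+-suc a (suc d)) (cong suc (ℕP.+-suc a d)))))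
                                              (ℕP.+-monoʳ-≤ a d<c)) b<n

    along-cycle : ∀ d → d < c → Σ (Fin n) λ q → iterate (next twisted) d cycle-start ≡ just q × toℕ q ≡ suc a ℕ.+ d
    along-cycle zero _ = cycle-start , refl , trans cycle-start-value (cong suc (sym (ℕP.+-identityʳ a)))
    along-cycle (suc d) d<c with along-cycle d (ℕP.<-trans (ℕP.n<1+n d) d<c)
    ... | q , e , v rewrite e | v | inside-fixed d d<c with fin-< (suc (suc a ℕ.+ d)) (inside<n d d<c)
    ... | q' , e' , v' = q' , e' , trans v' (cong suc (sym (ℕP.+-suc a d)))

    cycle-closes : ∀ c' → suc c' ≡ c → iterate (next twisted) (suc c') cycle-start ≡ just cycle-start
    cycle-closes c' eq with along-cycle c' (ℕP.≤-reflexive eq)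
    ... | q , e , v rewrite e | trans v (trans (sym (ℕP.+-suc a c')) (cong (a ℕ.+_) eq)) | swap-b =
      proj₁ (proj₂ (fin-< (suc a) 1+a<n))

    twisted-cycle : iterate (next twisted) c cycle-start ≡ just cycle-start
    twisted-cycle = subst (λ d → iterate (next twisted) d cycle-start ≡ just cycle-start) c'+1≡c
                          (cycle-closes (ℕ.pred c) c'+1≡c)
      where
      c'+1≡c : suc (ℕ.pred c) ≡ c
      c'+1≡c = ℕP.suc-pred c {{ℕ.>-nonZero c≥1}}

    module Views (_~_ : Fin n → Fin n → Set) (~refl : ∀ {x} → x ~ x) (~sym : ∀ {x y} → x ~ y → y ~ x)
                 (periodic : ∀ q₁ q₂ → toℕ q₂ ≡ toℕ q₁ ℕ.+ c → i ≤ toℕ q₁ ℕ.+ r → toℕ q₁ ≤ i ℕ.+ r → q₁ ~ q₂) where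
      open Labelled _~_ using (_≈_)

      sim-labels : ∀ {k q₁ q₂} → k ≤ r → Sim k (toℕ q₁) (toℕ q₂) → q₁ ~ q₂
      sim-labels {q₁ = q₁} k≤r (same e) = subst (q₁ ~_) (toℕ-injective e) ~refl
      sim-labels {k} {q₁} k≤r (ahead e lo hi) =
        periodic _ _ e (ℕP.≤-trans lo (ℕP.+-monoʳ-≤ (toℕ q₁) k≤r)) (ℕP.≤-trans hi (ℕP.+-monoʳ-≤ i k≤r))
      sim-labels {k} {q₁} {q₂} k≤r (behind e lo hi) =
        ~sym (periodic _ _ e (ℕP.≤-trans lo (ℕP.+-monoʳ-≤ (toℕ q₂) k≤r)) (ℕP.≤-trans hi (ℕP.+-monoʳ-≤ i k≤r)))

      simM-≈ : ∀ k X Y → k ≤ r → SimM k X Y → X ≈ Y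
      simM-≈ k (just q₁) (just q₂) k≤r s = sim-labels k≤r s
      simM-≈ k nothing nothing k≤r s = tt

      same-view : ∀ p t → ∣ t ∣ ≤ r → walk₁ p t ≈ walk₂ p t
      same-view p (+ m) m≤r = simM-≈ m _ _ m≤r (sim-forwards m p m≤r)
      same-view p -[1+ m ] m<r = simM-≈ (suc m) _ _ m<r (sim-backwards (suc m) p m<r)

module Pumping where

  open import Data.Nat using (ℕ; zero; suc; _≤_; _<_; _*_)
  import Data.Nat.Properties as ℕP
  open import Data.Fin using (Fin; toℕ; combine; remQuot) renaming (zero to fz; suc to fs)
  open import Data.Fin.Properties using (pigeonhole; remQuot-combine; toℕ<n)
  open import Data.Bool using (Bool; true; false; if_then_else_)
  open import Data.Product using (Σ; _×_; _,_; proj₁; proj₂)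
  open import Function using (_∘_)
  open import Relation.Binary.PropositionalEquality

  record Coding (X : Set) (_R_ : X → X → Set) : Set where
    field
      size : ℕ
      code : X → Fin size
      code-injective : ∀ x y → code x ≡ code y → x R y

  Bool-coding : Coding Bool _≡_
  Bool-coding = record { size = 2 ; code = λ b → if b then fs fz else fz ; code-injective = injective }
    where
    injective : ∀ x y → (if x then fs fz else fz) ≡ (if y then fs fz else fz) → x ≡ y
    injective false false _ = refl
    injective true true _ = refl

  Pointwise : ∀ {X : Set} A (R : X → X → Set) → (Fin A → X) → (Fin A → X) → Set
  Pointwise A R f g = ∀ i → R (f i) (g i)

  function-coding : ∀ {X : Set} {R : X → X → Set} A → Coding X R → Coding (Fin A → X) (Pointwise A R)
  function-coding zero C = record { size = 1 ; code = λ _ → fz ; code-injective = λ _ _ _ () }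
  function-coding {X} {R} (suc A) C =
    record { size = Coding.size C * Coding.size rest ; code = code ; code-injective = injective }
    where
    rest : Coding (Fin A → X) (Pointwise A R)
    rest = function-coding A C
    code : (Fin (suc A) → X) → Fin (Coding.size C * Coding.size rest)
    code f = combine (Coding.code C (f fz)) (Coding.code rest (f ∘ fs))
    injective : ∀ f g → code f ≡ code g → Pointwise (suc A) R f g
    injective f g e = pointwise
      where
      parts : (Coding.code C (f fz) , Coding.code rest (f ∘ fs)) ≡ (Coding.code C (g fz) , Coding.code rest (g ∘ fs))
      parts = trans (sym (remQuot-combine {k = Coding.size rest} (Coding.code C (f fz)) (Coding.code rest (f ∘ fs))))
                (trans (cong (remQuot (Coding.size rest)) e) (remQuot-combine (Coding.code C (g fz)) (Coding.code rest (g ∘ fs))))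
      pointwise : Pointwise (suc A) R f g
      pointwise fz = Coding.code-injective C _ _ (cong proj₁ parts)
      pointwise (fs i) = Coding.code-injective rest _ _ (cong proj₂ parts) i

  pumping : ∀ {X : Set} {R : X → X → Set} (C : Coding X R) (w : ℕ → X) →
            Σ ℕ λ m₁ → Σ ℕ λ m₂ → m₁ < m₂ × m₂ ≤ Coding.size C × R (w m₁) (w m₂)
  pumping C w with pigeonhole (ℕP.n<1+n (Coding.size C)) (λ m → Coding.code C (w (toℕ m)))
  ... | i , j , i<j , e = toℕ i , toℕ j , i<j , ℕP.≤-pred (toℕ<n j) , Coding.code-injective C _ _ e

module Retwisting where

  open import Data.Nat as ℕ using (ℕ; zero; suc; _≤_; z≤n; _^_)
  import Data.Nat.Properties as ℕP
  open import Data.Integer as ℤ using (+_; ∣_∣)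
  open import Data.Fin using (Fin; toℕ) renaming (zero to fz; suc to fs)
  open import Data.Fin.Properties using (toℕ-injective; all?) renaming (_≟_ to _≟F_)
  open import Data.Bool using (true)
  import Data.Bool.Properties as BP
  open import Data.Maybe using (just)
  import Data.Maybe.Properties as MP
  open import Data.Product using (Σ; _×_; _,_; proj₁; proj₂)
  open import Data.Empty using (⊥-elim)
  open import Function using (_∘_)
  open import Function.Bundles using (_↔_; Inverse; Equivalence)
  open import Relation.Nullary using (¬_; Dec; yes; no)
  open import Relation.Nullary.Decidable using (⌊_⌋; _×-dec_)
  open import Relation.Binary.PropositionalEquality
  open import Defs
  open Walks
  open Lines
  open LocalIsos
  open BackAndForth

  holds→true : ∀ {P : Set} (d : Dec P) → P → ⌊ d ⌋ ≡ true
  holds→true (yes _) _ = refl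
  holds→true (no ¬p) p = ⊥-elim (¬p p)

  true→holds : ∀ {P : Set} (d : Dec P) → ⌊ d ⌋ ≡ true → P
  true→holds (yes p) _ = p

  module Rewire {k N h : ℕ} (M : Structure k) (isGrid : ReductIsoGrid M N h) where
    n : ℕ
    n = suc N

    open OnFin n

    iso : Fin (size M) ↔ GridPt N h
    iso = proj₁ isGrid

    to : Fin (size M) → GridPt N h
    to = Inverse.to iso

    from : GridPt N h → Fin (size M)
    from = Inverse.from iso

    to-from : ∀ p → to (from p) ≡ p
    to-from = Inverse.strictlyInverseˡ iso

    from-to : ∀ e → from (to e) ≡ e
    from-to = Inverse.strictlyInverseʳ iso

    col : Fin (size M) → Fin n
    col e = proj₁ (to e)

    row : Fin (size M) → Fin (suc h)
    row e = proj₂ (to e)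

    col-row-injective : ∀ e₁ e₂ → col e₁ ≡ col e₂ → row e₁ ≡ row e₂ → e₁ ≡ e₂
    col-row-injective e₁ e₂ c r = trans (sym (from-to e₁)) (trans (cong from (cong₂ _,_ c r)) (from-to e₂))

    _~_ : Fin n → Fin n → Set
    p ~ p' = ∀ y v → unOf M v (from (p , y)) ≡ unOf M v (from (p' , y))

    ~-refl : ∀ {x} → x ~ x
    ~-refl y v = refl

    ~-sym : ∀ {x y} → x ~ y → y ~ x
    ~-sym e y v = sym (e y v)

    ~-trans : ∀ {x y z} → x ~ y → y ~ z → x ~ z
    ~-trans e f y v = trans (e y v) (f y v)

    ~-dec : ∀ x y → Dec (x ~ y)
    ~-dec x x' = all? (λ y → all? (λ v → unOf M v (from (x , y)) BP.≟ unOf M v (from (x' , y))))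

    Adjacent : PartialSucc n → BinSym → GridPt N h → GridPt N h → Set
    Adjacent G R (x , y) (x' , y') = PartialSucc.next G x ≡ just x' × y ≡ y'
    Adjacent G L (x , y) (x' , y') = PartialSucc.next G x' ≡ just x × y ≡ y'
    Adjacent G U (x , y) (x' , y') = x ≡ x' × toℕ y ≡ suc (toℕ y')
    Adjacent G D (x , y) (x' , y') = x ≡ x' × toℕ y' ≡ suc (toℕ y)

    adjacent? : ∀ G s p p' → Dec (Adjacent G s p p')
    adjacent? G R (x , y) (x' , y') = MP.≡-dec _≟F_ (PartialSucc.next G x) (just x') ×-dec (y ≟F y')
    adjacent? G L (x , y) (x' , y') = MP.≡-dec _≟F_ (PartialSucc.next G x') (just x) ×-dec (y ≟F y')
    adjacent? G U (x , y) (x' , y') = (x ≟F x') ×-dec (toℕ y ℕ.≟ suc (toℕ y'))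
    adjacent? G D (x , y) (x' , y') = (x ≟F x') ×-dec (toℕ y' ℕ.≟ suc (toℕ y))

    retwist : PartialSucc n → Structure k
    retwist G = record { size = size M ; relOf = λ s e₁ e₂ → ⌊ adjacent? G s (to e₁) (to e₂) ⌋ ; unOf = unOf M }

    grid→adjacent : ∀ s p p' → gridRel s p p' → Adjacent straight s p p'
    grid→adjacent R p p' (e₁ , e₂) = straight-next⁻¹ e₁ , toℕ-injective e₂
    grid→adjacent L p p' (e₁ , e₂) = straight-next⁻¹ e₁ , toℕ-injective e₂
    grid→adjacent U p p' (e₁ , e₂) = toℕ-injective e₁ , e₂
    grid→adjacent D p p' (e₁ , e₂) = toℕ-injective e₁ , e₂

    adjacent→grid : ∀ s p p' → Adjacent straight s p p' → gridRel s p p'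
    adjacent→grid R p p' (e₁ , e₂) = straight-next e₁ , cong toℕ e₂
    adjacent→grid L p p' (e₁ , e₂) = straight-next e₁ , cong toℕ e₂
    adjacent→grid U p p' (e₁ , e₂) = cong toℕ e₁ , e₂
    adjacent→grid D p p' (e₁ , e₂) = cong toℕ e₁ , e₂

    adjacent-transfer : ∀ (G₁ G₂ : PartialSucc n) s (p₁ p₂ p₁' p₂' : GridPt N h) →
      (∀ t → ∣ t ∣ ≤ 1 → Walk.walk G₁ (proj₁ p₁) t ≡ just (proj₁ p₂) → Walk.walk G₂ (proj₁ p₁') t ≡ just (proj₁ p₂')) →
      (∀ t → ∣ t ∣ ≤ 1 → Walk.walk G₁ (proj₁ p₂) t ≡ just (proj₁ p₁) → Walk.walk G₂ (proj₁ p₂') t ≡ just (proj₁ p₁')) →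
      proj₂ p₁ ≡ proj₂ p₁' → proj₂ p₂ ≡ proj₂ p₂' → Adjacent G₁ s p₁ p₂ → Adjacent G₂ s p₁' p₂'
    adjacent-transfer G₁ G₂ R p₁ p₂ p₁' p₂' f₁₂ f₂₁ r₁ r₂ (e₁ , e₂) = f₁₂ (+ 1) ℕP.≤-refl e₁ , trans (sym r₁) (trans e₂ r₂)
    adjacent-transfer G₁ G₂ L p₁ p₂ p₁' p₂' f₁₂ f₂₁ r₁ r₂ (e₁ , e₂) = f₂₁ (+ 1) ℕP.≤-refl e₁ , trans (sym r₁) (trans e₂ r₂)
    adjacent-transfer G₁ G₂ U p₁ p₂ p₁' p₂' f₁₂ f₂₁ r₁ r₂ (e₁ , e₂) =
      MP.just-injective (f₁₂ (+ 0) z≤n (cong just e₁)) , trans (cong toℕ (sym r₁)) (trans e₂ (cong (suc ∘ toℕ) r₂))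
    adjacent-transfer G₁ G₂ D p₁ p₂ p₁' p₂' f₁₂ f₂₁ r₁ r₂ (e₁ , e₂) =
      MP.just-injective (f₁₂ (+ 0) z≤n (cong just e₁)) , trans (cong toℕ (sym r₂)) (trans e₂ (cong (suc ∘ toℕ) r₁))

    -- If G has a cycle of positive length, retwist G is not a grid: each R-step
    -- of the cycle would increase the first grid coordinate.
    cycle⇒not-grid : ∀ G c p → 1 ≤ c → iterate (PartialSucc.next G) c p ≡ just p → ¬ ReductIsGrid (retwist G)
    cycle⇒not-grid G c p c≥1 cyc (xs , ys , iso' , rel') =
      ℕP.<-irrefl (along c cyc) (ℕP.m<m+n (X (on-row-0 p)) c≥1)
      where
      on-row-0 : Fin n → Fin (size M)
      on-row-0 p = from (p , fz)
      X : Fin (size M) → ℕ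
      X e = toℕ (proj₁ (Inverse.to iso' e))
      step : ∀ {r q} → PartialSucc.next G r ≡ just q → X (on-row-0 q) ≡ suc (X (on-row-0 r))
      step {r} {q} e = proj₁ (Equivalence.to (rel' R (on-row-0 r) (on-row-0 q))
        (holds→true (adjacent? G R (to (on-row-0 r)) (to (on-row-0 q)))
                  (subst₂ (Adjacent G R) (sym (to-from (r , fz))) (sym (to-from (q , fz))) (e , refl))))
      along : ∀ d {q} → iterate (PartialSucc.next G) d p ≡ just q → X (on-row-0 q) ≡ X (on-row-0 p) ℕ.+ d
      along zero refl = sym (ℕP.+-identityʳ _)
      along (suc d) e with >>=-just (iterate (PartialSucc.next G) d p) (PartialSucc.next G) e
      ... | r , e₁ , e₂ = trans (step e₂) (trans (cong suc (along d e₁)) (sym (ℕP.+-suc _ d)))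

    -- The back-and-forth system pairs assignments with equal rows whose
    -- columns form a local isomorphism of radius 2^g, g being the rounds left.
    module Equivalent (G : PartialSucc n) (q : ℕ)
        (same-view : ∀ p t → ∣ t ∣ ≤ 2 ^ q → Labelled._≈_ _~_ (Walk.walk straight p t) (Walk.walk G p t))
        (acyclic : ∀ p t → ∣ t ∣ ≤ 2 ^ q → Walk.walk G p t ≡ just p → t ≡ + 0) where
      open Labelled _~_
      open Symmetric ~-sym ~-trans

      private
        B : Structure k
        B = retwist G

        module Forth = Extension straight G ~-sym ~-trans ~-dec (2 ^ q) same-view
                                 (λ p t _ → straight-acyclic p t) acyclic
        module Back = Extension G straight ~-sym ~-trans ~-dec (2 ^ q)
                                (λ p t le → ≈-sym {Walk.walk straight p t} (same-view p t le))
                                acyclic (λ p t _ → straight-acyclic p t)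

      Linked : ℕ → (m : ℕ) → (Fin m → Fin (size M)) → (Fin m → Fin (size M)) → Set
      Linked g m ρ σ = g ≤ q × (∀ l → row (ρ l) ≡ row (σ l)) × LocalIso straight G (2 ^ g) m (col ∘ ρ) (col ∘ σ)

      -- Linked assignments agree on atomic formulas: relations transfer along links of
      -- length ≤ 1, predicates along views of length 0, equality along links of length 0.
      linked-rel : ∀ {g m ρ σ} → Linked g m ρ σ → ∀ s i j → relOf M s (ρ i) (ρ j) ≡ relOf B s (σ i) (σ j)
      linked-rel {g} {m} {ρ} {σ} (_ , rows , I) s i j = true-iff into out-of
        where
        1≤r : 1 ≤ 2 ^ g
        1≤r = ℕP.m^n>0 2 g
        into : relOf M s (ρ i) (ρ j) ≡ true → relOf B s (σ i) (σ j) ≡ true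
        into e = holds→true (adjacent? G s (to (σ i)) (to (σ j)))
          (adjacent-transfer straight G s (to (ρ i)) (to (ρ j)) (to (σ i)) (to (σ j))
            (λ t le → LocalIso.links I i j t (ℕP.≤-trans le 1≤r)) (λ t le → LocalIso.links I j i t (ℕP.≤-trans le 1≤r))
            (rows i) (rows j) (grid→adjacent s _ _ (Equivalence.to (proj₂ isGrid s (ρ i) (ρ j)) e)))
        out-of : relOf B s (σ i) (σ j) ≡ true → relOf M s (ρ i) (ρ j) ≡ true
        out-of e = Equivalence.from (proj₂ isGrid s (ρ i) (ρ j)) (adjacent→grid s _ _
          (adjacent-transfer G straight s (to (σ i)) (to (σ j)) (to (ρ i)) (to (ρ j))
            (λ t le → LocalIso.links' I i j t (ℕP.≤-trans le 1≤r)) (λ t le → LocalIso.links' I j i t (ℕP.≤-trans le 1≤r))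
            (sym (rows i)) (sym (rows j)) (true→holds (adjacent? G s (to (σ i)) (to (σ j))) e)))

      linked-un : ∀ {g m ρ σ} → Linked g m ρ σ → ∀ u i → unOf M u (ρ i) ≡ unOf B u (σ i)
      linked-un {g} {m} {ρ} {σ} (_ , rows , I) u i = begin
        unOf M u (ρ i)                        ≡⟨ cong (unOf M u) (sym (from-to (ρ i))) ⟩
        unOf M u (from (col (ρ i) , row (ρ i))) ≡⟨ LocalIso.views I i (+ 0) z≤n (row (ρ i)) u ⟩
        unOf M u (from (col (σ i) , row (ρ i))) ≡⟨ cong (λ y → unOf M u (from (col (σ i) , y))) (rows i) ⟩
        unOf M u (from (col (σ i) , row (σ i))) ≡⟨ cong (unOf M u) (from-to (σ i)) ⟩
        unOf M u (σ i)                        ∎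
        where open ≡-Reasoning

      linked-eq : ∀ {g m ρ σ} → Linked g m ρ σ → ∀ i j → ⌊ ρ i ≟F ρ j ⌋ ≡ ⌊ σ i ≟F σ j ⌋
      linked-eq {g} {m} {ρ} {σ} (_ , rows , I) i j = true-iff into out-of
        where
        into : ⌊ ρ i ≟F ρ j ⌋ ≡ true → ⌊ σ i ≟F σ j ⌋ ≡ true
        into e = holds→true (σ i ≟F σ j) (col-row-injective (σ i) (σ j)
          (MP.just-injective (LocalIso.links I i j (+ 0) z≤n (cong (just ∘ col) ρi≡ρj)))
          (trans (sym (rows i)) (trans (cong row ρi≡ρj) (rows j))))
          where
          ρi≡ρj : ρ i ≡ ρ j
          ρi≡ρj = true→holds (ρ i ≟F ρ j) e
        out-of : ⌊ σ i ≟F σ j ⌋ ≡ true → ⌊ ρ i ≟F ρ j ⌋ ≡ true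
        out-of e = holds→true (ρ i ≟F ρ j) (col-row-injective (ρ i) (ρ j)
          (MP.just-injective (LocalIso.links' I i j (+ 0) z≤n (cong (just ∘ col) σi≡σj)))
          (trans (rows i) (trans (cong row σi≡σj) (sym (rows j)))))
          where
          σi≡σj : σ i ≡ σ j
          σi≡σj = true→holds (σ i ≟F σ j) e

      extend-linked : ∀ {g m ρ σ} e e' {p p'} → col e ≡ p → col e' ≡ p' → row e ≡ row e' → g ≤ q →
                      (∀ l → row (ρ l) ≡ row (σ l)) →
                      LocalIso straight G (2 ^ g) (suc m) (extend p (col ∘ ρ)) (extend p' (col ∘ σ)) →
                      Linked g (suc m) (extend e ρ) (extend e' σ)
      extend-linked {ρ = ρ} {σ} e e' cp cp' r g≤q rows I = g≤q , rows' , LocalIso-cong cols cols' I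
        where
        rows' : ∀ l → row (extend e ρ l) ≡ row (extend e' σ l)
        rows' fz = r
        rows' (fs l) = rows l
        cols : ∀ l → extend _ (col ∘ ρ) l ≡ col (extend e ρ l)
        cols fz = sym cp
        cols (fs l) = refl
        cols' : ∀ l → extend _ (col ∘ σ) l ≡ col (extend e' σ l)
        cols' fz = sym cp'
        cols' (fs l) = refl

      -- Forth and back moves are extension steps from radius 2^(g+1) to radius 2^g.
      radius-halves : ∀ g → 2 ^ g ℕ.+ 2 ^ g ≤ 2 ^ suc g
      radius-halves g = ℕP.≤-reflexive (cong (2 ^ g ℕ.+_) (sym (ℕP.+-identityʳ _)))

      linked-forth : ∀ {g m ρ σ} → Linked (suc g) m ρ σ → ∀ e → Σ (Fin (size B)) λ e' → Linked g (suc m) (extend e ρ) (extend e' σ)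
      linked-forth {g} (g<q , rows , I) e
        with Forth.extend-iso (2 ^ g) (2 ^ suc g) (radius-halves g) (ℕP.^-monoʳ-≤ 2 g<q) I (col e)
      ... | p' , I' = from (p' , row e) ,
        extend-linked e (from (p' , row e)) refl (cong proj₁ (to-from (p' , row e)))
                      (sym (cong proj₂ (to-from (p' , row e)))) (ℕP.<⇒≤ g<q) rows I'

      linked-back : ∀ {g m ρ σ} → Linked (suc g) m ρ σ → ∀ e' → Σ (Fin (size M)) λ e → Linked g (suc m) (extend e ρ) (extend e' σ)
      linked-back {g} (g<q , rows , I) e'
        with Back.extend-iso (2 ^ g) (2 ^ suc g) (radius-halves g) (ℕP.^-monoʳ-≤ 2 g<q) (LocalIso-sym I) (col e')
      ... | p , I' = from (p , row e') ,
        extend-linked (from (p , row e')) e' (cong proj₁ (to-from (p , row e'))) refl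
                      (cong proj₂ (to-from (p , row e'))) (ℕP.<⇒≤ g<q) rows (LocalIso-sym I')

      linked-start : Linked q 0 noVars noVars
      linked-start = ℕP.≤-refl , (λ ()) , record { views = λ () ; links = λ () ; links' = λ () }

      retwist-⊨ : ∀ φ → rank φ ≤ q → M ⊨ φ → retwist G ⊨ φ
      retwist-⊨ φ φ≤q M⊨φ =
        trans (sym (Soundness.same-truth M B Linked linked-rel linked-un linked-eq linked-forth linked-back
                                         φ q φ≤q linked-start)) M⊨φ

module Contradiction where

  open import Data.Nat as ℕ using (ℕ; suc; _≤_; _<_; s≤s; _*_; _^_; _∸_)
  import Data.Nat.Properties as ℕP
  open import Data.Fin using (Fin; toℕ; fromℕ<)
  open import Data.Fin.Properties using (toℕ-fromℕ<)
  open import Data.Bool using (Bool; false)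
  open import Data.Maybe using (just; nothing)
  open import Data.Product using (Σ; _×_; _,_; proj₁; proj₂)
  open import Data.Empty using (⊥)
  open import Relation.Binary.PropositionalEquality
  open import Defs
  open Lines
  open BackAndForth using (rank)
  open Pumping
  open import Algebra.Properties.CommutativeSemigroup ℕP.+-commutativeSemigroup using (xy∙z≈xz∙y)
  open Retwisting

  module _ (k : ℕ) (φ : Sentence k) (h : ℕ)
           (grids : ∀ (M : Structure k) → M ⊨ φ → ReductIsGrid M)
           (models : ∀ xs → Σ (Structure k) λ M → M ⊨ φ × ReductIsoGrid M xs h) where

    q : ℕ
    q = rank φ

    -- The radius of indistinguishability, and the spacing of candidate windows.
    r : ℕ
    r = 2 ^ q

    S : ℕ
    S = suc (suc r)

    Column : Set
    Column = Fin (suc h) → Fin k → Bool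

    window-coding : Coding (Fin (suc (r ℕ.+ r)) → Column) (Pointwise (suc (r ℕ.+ r)) (Pointwise (suc h) (Pointwise k _≡_)))
    window-coding = function-coding (suc (r ℕ.+ r)) (function-coding (suc h) (function-coding k Bool-coding))

    K : ℕ
    K = Coding.size window-coding

    -- The width is large enough to hold K + 1 windows spaced S apart.
    N : ℕ
    N = suc (K * S ℕ.+ r ℕ.+ r)

    M : Structure k
    M = proj₁ (models N)

    M⊨φ : M ⊨ φ
    M⊨φ = proj₁ (proj₂ (models N))

    isGrid : ReductIsoGrid M N h
    isGrid = proj₂ (proj₂ (models N))

    open Rewire M isGrid
    open OnFin n

    column : ℕ → Column
    column x y v with fin x
    ... | just p = unOf M v (from (p , y))
    ... | nothing = false

    column-toℕ : ∀ p y v → column (toℕ p) y v ≡ unOf M v (from (p , y))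
    column-toℕ p y v rewrite fin-toℕ p = refl

    window : ℕ → Fin (suc (r ℕ.+ r)) → Column
    window m d = column (suc (m * S) ℕ.+ toℕ d)

    pumped : Σ ℕ λ m₁ → Σ ℕ λ m₂ → m₁ < m₂ × m₂ ≤ K ×
             Pointwise (suc (r ℕ.+ r)) (Pointwise (suc h) (Pointwise k _≡_)) (window m₁) (window m₂)
    pumped = pumping window-coding window

    m₁ m₂ : ℕ
    m₁ = proj₁ pumped
    m₂ = proj₁ (proj₂ pumped)

    m₁<m₂ : m₁ < m₂
    m₁<m₂ = proj₁ (proj₂ (proj₂ pumped))

    m₂≤K : m₂ ≤ K
    m₂≤K = proj₁ (proj₂ (proj₂ (proj₂ pumped)))

    equal-windows : ∀ d y v → window m₁ d y v ≡ window m₂ d y v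
    equal-windows = proj₂ (proj₂ (proj₂ (proj₂ pumped)))

    -- The twist happens at a (the centre of the first window, minus one) and at
    -- b = a + c, c being the distance between the windows.
    u a c : ℕ
    u = m₁ * S
    a = u ℕ.+ r
    c = (m₂ ∸ m₁) * S

    u+c≡m₂S : u ℕ.+ c ≡ m₂ * S
    u+c≡m₂S = trans (sym (ℕP.*-distribʳ-+ S m₁ (m₂ ∸ m₁))) (cong (_* S) (ℕP.m+[n∸m]≡n (ℕP.<⇒≤ m₁<m₂)))

    r+2≤c : suc (suc r) ≤ c
    r+2≤c = ℕP.≤-trans (ℕP.≤-reflexive (sym (ℕP.*-identityˡ S))) (ℕP.*-monoˡ-≤ S (ℕP.m<n⇒0<n∸m m₁<m₂))

    r≤a : r ≤ a
    r≤a = ℕP.m≤n+m r u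

    room : suc (suc (a ℕ.+ c ℕ.+ r)) ≤ n
    room = s≤s (s≤s (ℕP.+-monoˡ-≤ r (ℕP.≤-trans (ℕP.≤-reflexive a+c≡m₂S+r) (ℕP.+-monoˡ-≤ r (ℕP.*-monoˡ-≤ S m₂≤K)))))
      where
      a+c≡m₂S+r : a ℕ.+ c ≡ m₂ * S ℕ.+ r
      a+c≡m₂S+r = trans (ℕP.+-assoc u r c) (trans (cong (u ℕ.+_) (ℕP.+-comm r c))
                        (trans (sym (ℕP.+-assoc u c r)) (cong (ℕ._+ r) u+c≡m₂S)))

    periodic : ∀ q₁ q₂ → toℕ q₂ ≡ toℕ q₁ ℕ.+ c → suc a ≤ toℕ q₁ ℕ.+ r → toℕ q₁ ≤ suc a ℕ.+ r → q₁ ~ q₂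
    periodic q₁ q₂ e lo hi y v = begin
      unOf M v (from (q₁ , y))           ≡⟨ sym (column-toℕ q₁ y v) ⟩
      column (toℕ q₁) y v                ≡⟨ cong (λ x → column x y v) (sym in-window₁) ⟩
      window m₁ d y v                    ≡⟨ equal-windows d y v ⟩
      window m₂ d y v                    ≡⟨ cong (λ x → column x y v) in-window₂ ⟩
      column (toℕ q₂) y v                ≡⟨ column-toℕ q₂ y v ⟩
      unOf M v (from (q₂ , y))           ∎
      where
      open ≡-Reasoning
      start≤q₁ : suc u ≤ toℕ q₁
      start≤q₁ = ℕP.+-cancelʳ-≤ r (suc u) (toℕ q₁) lo
      offset≤ : toℕ q₁ ∸ suc u ≤ r ℕ.+ r
      offset≤ = ℕP.≤-trans (ℕP.∸-monoˡ-≤ (suc u) hi)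
                  (ℕP.≤-reflexive (trans (cong (_∸ suc u) (ℕP.+-assoc (suc u) r r)) (ℕP.m+n∸m≡n (suc u) (r ℕ.+ r))))
      d : Fin (suc (r ℕ.+ r))
      d = fromℕ< (s≤s offset≤)
      in-window₁ : suc u ℕ.+ toℕ d ≡ toℕ q₁
      in-window₁ = trans (cong (suc u ℕ.+_) (toℕ-fromℕ< (s≤s offset≤))) (ℕP.m+[n∸m]≡n start≤q₁)
      in-window₂ : suc (m₂ * S) ℕ.+ toℕ d ≡ toℕ q₂
      in-window₂ = begin
        suc (m₂ * S) ℕ.+ toℕ d ≡⟨ cong (λ w → suc w ℕ.+ toℕ d) (sym u+c≡m₂S) ⟩
        suc (u ℕ.+ c ℕ.+ toℕ d) ≡⟨ cong suc (xy∙z≈xz∙y u c (toℕ d)) ⟩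
        suc (u ℕ.+ toℕ d ℕ.+ c) ≡⟨ cong (ℕ._+ c) in-window₁ ⟩
        toℕ q₁ ℕ.+ c            ≡⟨ sym e ⟩
        toℕ q₂                  ∎

    open Twisted.At n a c r r+2≤c r≤a room
    open Views _~_ ~-refl ~-sym periodic

    twisted⊨φ : retwist twisted ⊨ φ
    twisted⊨φ = Equivalent.retwist-⊨ twisted q same-view twisted-acyclic φ ℕP.≤-refl M⊨φ

    contradiction : ⊥
    contradiction = cycle⇒not-grid twisted c cycle-start c≥1 twisted-cycle (grids (retwist twisted) twisted⊨φ)

open import Defs
open import Data.Nat using (ℕ)
open import Data.Product using (_×_; ∃-syntax; _,_)
open import Relation.Nullary using (¬_)

no-fixed-height-grids : ∀ k (φ : Sentence k) → ¬ DefinesFixedHeightGrids φ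
no-fixed-height-grids k φ (grids , h , models) = Contradiction.contradiction k φ h grids models

-- Part (1) follows from part (2) at height 0.
theorem5 : ∀ (k : ℕ) →
    (¬ (∃[ φ ] DefinesGrids {k} φ)) × (¬ (∃[ φ ] DefinesFixedHeightGrids {k} φ))
theorem5 k = (λ { (φ , grids , models) → no-fixed-height-grids k φ (grids , 0 , λ xs → models xs 0) })
           , (λ { (φ , defines) → no-fixed-height-grids k φ defines })
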